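{- Let $T_1=\{3214,3241,4213,4231\}$ and $T_2=\{3124,3142,4123,4132\}$. For each of the three statistics "first element" $\sigma\mapsto\sigma(1)$, "position of the maximum symbol" $\sigma\mapsto\sigma^{ -1}(n)$, and "number of left-to-right maxima", the statistic is equidistributed over $S_n(T_1)$ and $S_n(T_2)$ for every $n\ge1$; that is, for every value $j$, the number of $\sigma\in S_n(T_1)$ with statistic equal to $j$ equals the number of $\sigma\in S_n(T_2)$ with statistic equal to $j$.
   Context: A permutation $\sigma$ avoids $\tau$ if no subsequence of $\sigma$ has the same relative order as $\tau$; $S_n(T)$ is the set of permutations in $S_n$ avoiding every pattern in $T$. An entry $\sigma(i)$ is a left-to-right maximum if $\sigma(i)\ge\sigma(j)$ for all $j\le i$. -}

module Defs where

open import Data.Nat using (ℕ; zero; suc; _<ᵇ_; _≡ᵇ_)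
open import Data.Bool using (Bool; true; false; _∧_; _∨_; not; if_then_else_)
open import Data.List using (List; []; _∷_; map; concatMap; filter; length; upTo)
open import Data.Bool.ListAction using (all; any)
open import Data.List.Relation.Unary.Unique.Propositional using (Unique)
open import Data.List.Relation.Unary.Unique.DecPropositional using (unique?)
open import Data.Nat.Properties using (_≟_)
open import Relation.Nullary.Decidable using (⌊_⌋)
open import Function using (_∘_)

-- Permutations are in one-line notation: σ = σ(1) σ(2) … σ(n) as a list of ℕ.

oneTo : ℕ → List ℕ
oneTo n = map suc (upTo n)

words : ℕ → ℕ → List (List ℕ)
words n zero    = [] ∷ []
words n (suc k) = concatMap (λ a → map (a ∷_) (words n k)) (oneTo n)

S : ℕ → List (List ℕ)
S n = filter (λ w → unique? _≟_ w) (words n n)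

subseqs : List ℕ → List (List ℕ)
subseqs []       = [] ∷ []
subseqs (x ∷ xs) = map (x ∷_) (subseqs xs) Data.List.++ subseqs xs

orderPairs : List ℕ → List (Bool)
orderPairs []       = []
orderPairs (x ∷ xs) = map (λ y → x <ᵇ y) xs Data.List.++ orderPairs xs

sameLen : List ℕ → List ℕ → Bool
sameLen []       []       = true
sameLen (_ ∷ xs) (_ ∷ ys) = sameLen xs ys
sameLen _        _        = false

boolEq : Bool → Bool → Bool
boolEq true  b = b
boolEq false b = not b

zipEq : List Bool → List Bool → Bool
zipEq []       []       = true
zipEq (a ∷ as) (b ∷ bs) = boolEq a b ∧ zipEq as bs
zipEq _        _        = false

orderIso : List ℕ → List ℕ → Bool
orderIso xs ys = sameLen xs ys ∧ zipEq (orderPairs xs) (orderPairs ys)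

contains : List ℕ → List ℕ → Bool
contains σ τ = any (λ s → orderIso s τ) (subseqs σ)

avoidsAll : List (List ℕ) → List ℕ → Bool
avoidsAll T σ = all (λ τ → not (contains σ τ)) T

Av : ℕ → List (List ℕ) → List (List ℕ)
Av n T = filter (λ σ → avoidsAll T σ Data.Bool.≟ true) (S n)

countStat : (List ℕ → ℕ) → ℕ → List (List ℕ) → ℕ
countStat st j L = length (filter (λ σ → st σ ≟ j) L)

T₁ : List (List ℕ)
T₁ = (3 ∷ 2 ∷ 1 ∷ 4 ∷ []) ∷ (3 ∷ 2 ∷ 4 ∷ 1 ∷ []) ∷ (4 ∷ 2 ∷ 1 ∷ 3 ∷ []) ∷ (4 ∷ 2 ∷ 3 ∷ 1 ∷ []) ∷ []

T₂ : List (List ℕ)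
T₂ = (3 ∷ 1 ∷ 2 ∷ 4 ∷ []) ∷ (3 ∷ 1 ∷ 4 ∷ 2 ∷ []) ∷ (4 ∷ 1 ∷ 2 ∷ 3 ∷ []) ∷ (4 ∷ 1 ∷ 3 ∷ 2 ∷ []) ∷ []

-- statistic: first element σ(1) (0 for the empty permutation, irrelevant as n ≥ 1)
first : List ℕ → ℕ
first []      = 0
first (x ∷ _) = x

-- statistic: position (1-based) of the maximum symbol n, i.e. σ⁻¹(n), for σ ∈ S n
posOf : ℕ → List ℕ → ℕ
posOf m []       = 0
posOf m (x ∷ xs) = if x ≡ᵇ m then 1 else suc (posOf m xs)

posMax : ℕ → List ℕ → ℕ
posMax n σ = posOf n σ

lrmaxFrom : ℕ → List ℕ → ℕ
lrmaxFrom m []       = 0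
lrmaxFrom m (x ∷ xs) = if m <ᵇ x then suc (lrmaxFrom x xs) else lrmaxFrom m xs

lrmax : List ℕ → ℕ
lrmax σ = lrmaxFrom 0 σ

module Submission where

-- Every pattern of T₁ and of T₂ is a letter followed by a smaller one, and raising
-- the first letter of an occurrence keeps it an occurrence.  So σ avoids T iff
-- every letter x of σ that is not a left-to-right maximum satisfies a local
-- condition D M x (suffix after x), M being the running maximum: for T₁ the
-- suffix lies entirely above or entirely below x; for T₂ a suffix letter in
-- (x, M) is the only suffix letter above x  (`avoids-T₁`, `avoids-T₂`).
-- Generate σ letter by letter from the state (unused letters R, maximum M).  A
-- new maximum is always allowed; the admissible non-maxima ("descents") all
-- lead to equivalent states and their number, `choices`, depends only on the
-- letters of R above M and the number below M, identically for T₁ and T₂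
-- (`countsDescents₁`, `countsDescents₂`).  By induction on the length, the
-- number of completions with a given shape (σ with non-maxima replaced by 0)
-- is the same for T₁ and T₂ (`Transfer.transfer`).  The three statistics are
-- functions of the shape, which gives the theorem.

open import Defs
open import Data.Nat using (ℕ; zero; suc; _+_; _*_; _<_; _≤_; _≥_; _<ᵇ_; _≡ᵇ_; z≤n; s≤s)
open import Data.Nat.Properties
  using (_≟_; <ᵇ⇒<; <⇒<ᵇ; ≡ᵇ⇒≡; ≡⇒≡ᵇ; <-cmp; <-trans; <-irrefl; ≤-refl; ≤-reflexive; <⇒≤; ≤-trans;
         <-≤-trans; ≤-<-trans; <⇒≢; ≮⇒≥; ≤∧≢⇒<; ≤-antisym; +-suc; +-identityʳ; suc-injective)
open import Data.Bool using (Bool; true; false; _∧_; _∨_; not; if_then_else_; T)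
import Data.Bool
open import Data.Bool.Properties
  using (∧-assoc; ∧-comm; ∨-assoc; ∨-comm; ∧-zeroʳ; ∧-identityʳ; ∨-zeroʳ; ∨-identityʳ;
         ∧-conicalˡ; ∧-conicalʳ; ∨-conicalˡ; ∨-conicalʳ)
open import Data.Bool.ListAction using (any; all)
open import Data.List using (List; []; _∷_; length; _++_; map; null; filter; concatMap; upTo)
open import Data.List.Properties using (length-map; length-upTo)
open import Data.List.Relation.Unary.All as All using (All; []; _∷_)
import Data.List.Relation.Unary.All.Properties as AllP
open import Data.List.Relation.Unary.Any using (Any; here; there)
import Data.List.Relation.Unary.Any.Properties as AnyP
open import Data.List.Relation.Unary.AllPairs using (AllPairs; []; _∷_)
import Data.List.Relation.Unary.AllPairs.Properties as AllPairsP
open import Data.List.Relation.Unary.Unique.DecPropositional using (unique?)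
open import Data.Empty using (⊥-elim)
open import Data.Unit using (tt)
open import Data.Product using (_×_; _,_; proj₁; proj₂; ∃)
open import Relation.Binary using (tri<; tri≈; tri>)
open import Relation.Binary.PropositionalEquality using (_≡_; refl; sym; trans; cong; cong₂; subst; _≢_; module ≡-Reasoning)
open import Relation.Nullary using (yes; no; does)
open import Relation.Unary using (Pred; Decidable)
open import Data.Nat.Solver using (module +-*-Solver)
import Level

T⇒≡true : ∀ {b} → T b → b ≡ true
T⇒≡true {true} _ = refl

true≢false : true ≢ false
true≢false ()

<ᵇ-true : ∀ {m n} → m < n → (m <ᵇ n) ≡ true
<ᵇ-true p = T⇒≡true (<⇒<ᵇ p)

<ᵇ-true⁻¹ : ∀ {m n} → (m <ᵇ n) ≡ true → m < n
<ᵇ-true⁻¹ {m} {n} e = <ᵇ⇒< m n (subst T (sym e) tt)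

<ᵇ-false : ∀ {m n} → n ≤ m → (m <ᵇ n) ≡ false
<ᵇ-false {m} {n} n≤m with m <ᵇ n in e
... | false = refl
... | true  = ⊥-elim (<-irrefl refl (≤-<-trans n≤m (<ᵇ-true⁻¹ e)))

<ᵇ-false⁻¹ : ∀ {m n} → (m <ᵇ n) ≡ false → n ≤ m
<ᵇ-false⁻¹ {m} {n} e = ≮⇒≥ (λ m<n → true≢false (trans (sym (<ᵇ-true {m} {n} m<n)) e))

≡ᵇ-refl : ∀ m → (m ≡ᵇ m) ≡ true
≡ᵇ-refl m = T⇒≡true (≡⇒≡ᵇ m m refl)

≡ᵇ-true⁻¹ : ∀ {m n} → (m ≡ᵇ n) ≡ true → m ≡ n
≡ᵇ-true⁻¹ {m} {n} e = ≡ᵇ⇒≡ m n (subst T (sym e) tt)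

≡ᵇ-false : ∀ {m n} → m ≢ n → (m ≡ᵇ n) ≡ false
≡ᵇ-false {m} {n} m≢n with m ≡ᵇ n in e
... | false = refl
... | true  = ⊥-elim (m≢n (≡ᵇ-true⁻¹ e))

≡ᵇ-false⁻¹ : ∀ {m n} → (m ≡ᵇ n) ≡ false → m ≢ n
≡ᵇ-false⁻¹ {m} e refl = true≢false (trans (sym (≡ᵇ-refl m)) e)

≡ᵇ-sym : ∀ a b → (a ≡ᵇ b) ≡ (b ≡ᵇ a)
≡ᵇ-sym a b with a ≡ᵇ b in e
... | true  = sym (T⇒≡true (≡⇒≡ᵇ b a (sym (≡ᵇ-true⁻¹ {a} {b} e))))
... | false = sym (≡ᵇ-false (λ b≡a → ≡ᵇ-false⁻¹ {a} {b} e (sym b≡a)))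

not-<ᵇ-flip : ∀ x M → x ≢ M → not (M <ᵇ x) ≡ (x <ᵇ M)
not-<ᵇ-flip x M x≢M with <-cmp x M
... | tri< x<M _ _ rewrite <ᵇ-false {M} {x} (<⇒≤ x<M) | <ᵇ-true x<M = refl
... | tri≈ _ x≡M _ = ⊥-elim (x≢M x≡M)
... | tri> _ _ M<x rewrite <ᵇ-true M<x | <ᵇ-false {x} {M} (<⇒≤ M<x) = refl

bool-ext : ∀ {a b : Bool} → (a ≡ true → b ≡ true) → (b ≡ true → a ≡ true) → a ≡ b
bool-ext {true}  {true}  f g = refl
bool-ext {true}  {false} f g = sym (f refl)
bool-ext {false} {true}  f g = g refl
bool-ext {false} {false} f g = refl

not-true : ∀ {p} → not p ≡ true → p ≡ false
not-true {false} _ = refl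

not-false : ∀ {p} → not p ≡ false → p ≡ true
not-false {true} _ = refl

countᵇ : {A : Set} → (A → Bool) → List A → ℕ
countᵇ p []       = 0
countᵇ p (x ∷ xs) = if p x then suc (countᵇ p xs) else countᵇ p xs

select : (ℕ → Bool) → List ℕ → List ℕ
select p []       = []
select p (x ∷ xs) = if p x then x ∷ select p xs else select p xs

elemᵇ : ℕ → List ℕ → Bool
elemᵇ a []       = false
elemᵇ a (x ∷ xs) = (a ≡ᵇ x) ∨ elemᵇ a xs

sumOver : List ℕ → (ℕ → ℕ) → ℕ
sumOver []       f = 0
sumOver (x ∷ xs) f = f x + sumOver xs f

module _ {A : Set} where

  countᵇ-cong : ∀ {p q : A → Bool} {L} → All (λ x → p x ≡ q x) L → countᵇ p L ≡ countᵇ q L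
  countᵇ-cong [] = refl
  countᵇ-cong {p} {q} {x ∷ xs} (e ∷ es) rewrite e | countᵇ-cong {p} {q} es = refl

  countᵇ-cong′ : ∀ {p q : A → Bool} L → (∀ x → p x ≡ q x) → countᵇ p L ≡ countᵇ q L
  countᵇ-cong′ L e = countᵇ-cong (All.universal e L)

  countᵇ-++ : ∀ (p : A → Bool) L M → countᵇ p (L ++ M) ≡ countᵇ p L + countᵇ p M
  countᵇ-++ p []      M = refl
  countᵇ-++ p (x ∷ L) M with p x
  ... | true  = cong suc (countᵇ-++ p L M)
  ... | false = countᵇ-++ p L M

  countᵇ-map : ∀ {B : Set} (p : B → Bool) (f : A → B) L → countᵇ p (map f L) ≡ countᵇ (λ x → p (f x)) L
  countᵇ-map p f [] = refl
  countᵇ-map p f (x ∷ L) with p (f x)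
  ... | true  = cong suc (countᵇ-map p f L)
  ... | false = countᵇ-map p f L

  countᵇ-guard : ∀ (b : Bool) (p : A → Bool) L → countᵇ (λ x → b ∧ p x) L ≡ (if b then countᵇ p L else 0)
  countᵇ-guard true  p L       = refl
  countᵇ-guard false p []      = refl
  countᵇ-guard false p (x ∷ L) = countᵇ-guard false p L

  countᵇ-false : ∀ (L : List A) → countᵇ (λ _ → false) L ≡ 0
  countᵇ-false []      = refl
  countᵇ-false (x ∷ L) = countᵇ-false L

  countᵇ-true : ∀ (L : List A) → countᵇ (λ _ → true) L ≡ length L
  countᵇ-true []      = refl
  countᵇ-true (x ∷ L) = cong suc (countᵇ-true L)

  countᵇ-split : ∀ (p q : A → Bool) L →
    countᵇ p L ≡ countᵇ (λ x → p x ∧ q x) L + countᵇ (λ x → p x ∧ not (q x)) L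
  countᵇ-split p q [] = refl
  countᵇ-split p q (x ∷ L) with p x | q x
  ... | true  | true  = cong suc (countᵇ-split p q L)
  ... | true  | false = trans (cong suc (countᵇ-split p q L)) (sym (+-suc _ _))
  ... | false | _     = countᵇ-split p q L

  countᵇ-suc : ∀ (p : A → Bool) L {m} → countᵇ p L ≡ suc m → ∃ λ a → p a ≡ true
  countᵇ-suc p (x ∷ L) e with p x in px
  ... | true  = x , px
  ... | false = countᵇ-suc p L e

countᵇ-select : ∀ (p q : ℕ → Bool) L → countᵇ q (select p L) ≡ countᵇ (λ x → p x ∧ q x) L
countᵇ-select p q [] = refl
countᵇ-select p q (x ∷ L) with p x
... | false = countᵇ-select p q L
... | true with q x
...   | true  = cong suc (countᵇ-select p q L)
...   | false = countᵇ-select p q L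

length-select : ∀ (p : ℕ → Bool) L → length (select p L) ≡ countᵇ p L
length-select p [] = refl
length-select p (x ∷ L) with p x
... | true  = cong suc (length-select p L)
... | false = length-select p L

select-select : ∀ (p q : ℕ → Bool) L → select q (select p L) ≡ select (λ x → p x ∧ q x) L
select-select p q [] = refl
select-select p q (x ∷ L) with p x
... | false = select-select p q L
... | true with q x
...   | true  = cong (x ∷_) (select-select p q L)
...   | false = select-select p q L

select-cong : ∀ {p q : ℕ → Bool} L → (∀ x → p x ≡ q x) → select p L ≡ select q L
select-cong [] e = refl
select-cong {p} {q} (x ∷ L) e rewrite e x | select-cong {p} {q} L e = refl

select-all : ∀ {p : ℕ → Bool} {L} → All (λ x → p x ≡ true) L → select p L ≡ L
select-all [] = refl
select-all {p} {x ∷ xs} (e ∷ es) rewrite e = cong (x ∷_) (select-all es)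

All-select : ∀ {P : ℕ → Set} (p : ℕ → Bool) {L} → All P L → All P (select p L)
All-select p [] = []
All-select p {x ∷ L} (px ∷ ps) with p x
... | true  = px ∷ All-select p ps
... | false = All-select p ps

All-select-pred : ∀ (p : ℕ → Bool) L → All (λ r → p r ≡ true) (select p L)
All-select-pred p [] = []
All-select-pred p (x ∷ L) with p x in e
... | true  = e ∷ All-select-pred p L
... | false = All-select-pred p L

AllPairs-select : ∀ {R : ℕ → ℕ → Set} (p : ℕ → Bool) {L} → AllPairs R L → AllPairs R (select p L)
AllPairs-select p [] = []
AllPairs-select p {x ∷ L} (a ∷ ps) with p x
... | true  = All-select p a ∷ AllPairs-select p ps
... | false = AllPairs-select p ps

elemᵇ⇒∈ : ∀ {a L} → elemᵇ a L ≡ true → Any (a ≡_) L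
elemᵇ⇒∈ {a} {x ∷ L} e with a ≡ᵇ x in ax
... | true  = here (≡ᵇ-true⁻¹ ax)
... | false = there (elemᵇ⇒∈ e)

∈⇒elemᵇ : ∀ {a L} → Any (a ≡_) L → elemᵇ a L ≡ true
∈⇒elemᵇ {a} (here refl) rewrite ≡ᵇ-refl a = refl
∈⇒elemᵇ {a} {x ∷ L} (there p) rewrite ∈⇒elemᵇ p = ∨-zeroʳ (a ≡ᵇ x)

elemᵇ-here : ∀ y L → elemᵇ y (y ∷ L) ≡ true
elemᵇ-here y L = ∈⇒elemᵇ {y} {y ∷ L} (here refl)

elemᵇ-there : ∀ {b} y L → elemᵇ b L ≡ true → elemᵇ b (y ∷ L) ≡ true
elemᵇ-there {b} y L e = ∈⇒elemᵇ (there (elemᵇ⇒∈ {b} {L} e))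

elemᵇ-tail : ∀ {y r L} → r ≢ y → elemᵇ r (y ∷ L) ≡ true → elemᵇ r L ≡ true
elemᵇ-tail r≢y e rewrite ≡ᵇ-false r≢y = e

All-elemᵇ : ∀ {P : ℕ → Set} {L} → All P L → ∀ {a} → elemᵇ a L ≡ true → P a
All-elemᵇ ps e = All.lookup ps (elemᵇ⇒∈ e)

elemᵇ-select : ∀ (p : ℕ → Bool) a L → elemᵇ a (select p L) ≡ p a ∧ elemᵇ a L
elemᵇ-select p a [] = sym (∧-zeroʳ (p a))
elemᵇ-select p a (x ∷ L) with p x in px | a ≡ᵇ x in ax
... | true  | true  = trans (cong (_∨ elemᵇ a (select p L)) ax) (sym (cong (_∧ true) pa))
  where pa = trans (cong p (≡ᵇ-true⁻¹ ax)) px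
... | true  | false = trans (cong (_∨ elemᵇ a (select p L)) ax) (elemᵇ-select p a L)
... | false | false = elemᵇ-select p a L
... | false | true  = trans (elemᵇ-select p a L) (trans (cong (_∧ elemᵇ a L) pa) (sym (cong (_∧ true) pa)))
  where pa = trans (cong p (≡ᵇ-true⁻¹ ax)) px

all⇒All : ∀ {p : ℕ → Bool} {L} → all p L ≡ true → All (λ x → p x ≡ true) L
all⇒All {p} {[]} e = []
all⇒All {p} {x ∷ L} e with p x in px
... | true = px ∷ all⇒All e

All⇒all : ∀ {p : ℕ → Bool} {L} → All (λ x → p x ≡ true) L → all p L ≡ true
All⇒all [] = refl
All⇒all (e ∷ es) rewrite e = All⇒all es

all-false⇒witness : ∀ {p : ℕ → Bool} {L} → all p L ≡ false → ∃ λ x → (elemᵇ x L ≡ true) × (p x ≡ false)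
all-false⇒witness {p} {x ∷ L} e with p x in px
... | false = x , elemᵇ-here x L , px
... | true with all-false⇒witness {p} {L} e
...   | y , y∈L , py = y , elemᵇ-there x L y∈L , py

witness⇒all-false : ∀ (p : ℕ → Bool) L {c} → elemᵇ c L ≡ true → p c ≡ false → all p L ≡ false
witness⇒all-false p (x ∷ L) {c} c∈L pc with c ≡ᵇ x in cx
... | true rewrite sym (≡ᵇ-true⁻¹ {c} {x} cx) | pc = refl
... | false = trans (cong (p x ∧_) (witness⇒all-false p L c∈L pc)) (∧-zeroʳ _)

all-cong : ∀ {p q : ℕ → Bool} L → (∀ x → p x ≡ q x) → all p L ≡ all q L
all-cong []      e = refl
all-cong (x ∷ L) e = cong₂ _∧_ (e x) (all-cong L e)

all-subset : ∀ {p : ℕ → Bool} {L L'} → (∀ z → elemᵇ z L ≡ true → elemᵇ z L' ≡ true) → all p L' ≡ true → all p L ≡ true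
all-subset {p} {L} {L'} s e =
  All⇒all {p} {L} (All.tabulate (λ {z} z∈L → All-elemᵇ (all⇒All {p} {L'} e) (s z (∈⇒elemᵇ {z} {L} z∈L))))

all-sameElems : ∀ p L L' → (∀ z → elemᵇ z L ≡ elemᵇ z L') → all p L ≡ all p L'
all-sameElems p L L' e = bool-ext (all-subset {p} {L'} {L} (λ z z∈L' → trans (e z) z∈L'))
                                  (all-subset {p} {L} {L'} (λ z z∈L → trans (sym (e z)) z∈L))

module _ {A : Set} where

  any-++ : ∀ (p : A → Bool) L M → any p (L ++ M) ≡ (any p L ∨ any p M)
  any-++ p []      M = refl
  any-++ p (x ∷ L) M rewrite any-++ p L M = sym (∨-assoc (p x) (any p L) (any p M))

  any-∨ : ∀ (f g : A → Bool) L → any (λ s → f s ∨ g s) L ≡ (any f L ∨ any g L)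
  any-∨ f g [] = refl
  any-∨ f g (x ∷ L) rewrite any-∨ f g L = interchange (f x) (g x) (any f L) (any g L)
    where
    interchange : ∀ a b c d → ((a ∨ b) ∨ (c ∨ d)) ≡ ((a ∨ c) ∨ (b ∨ d))
    interchange true  b     c d = refl
    interchange false true  c d = sym (∨-zeroʳ c)
    interchange false false c d = refl

  any-false : ∀ L → any (λ (_ : A) → false) L ≡ false
  any-false []      = refl
  any-false (x ∷ L) = any-false L

  any-cong : ∀ {f g : A → Bool} L → (∀ x → f x ≡ g x) → any f L ≡ any g L
  any-cong []      e = refl
  any-cong (x ∷ L) e = cong₂ _∨_ (e x) (any-cong L e)

  any-mono : ∀ {g h : A → Bool} L → (∀ s → g s ≡ true → h s ≡ true) → any g L ≡ true → any h L ≡ true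
  any-mono {g} (x ∷ L) f e with g x in gx
  ... | true rewrite f x gx = refl
  ... | false = trans (cong (_ ∨_) (any-mono L f e)) (∨-zeroʳ _)

any-map : ∀ {A B : Set} (p : B → Bool) (f : A → B) L → any p (map f L) ≡ any (λ x → p (f x)) L
any-map p f []      = refl
any-map p f (x ∷ L) = cong (p (f x) ∨_) (any-map p f L)

any⇒witness : ∀ (p : ℕ → Bool) L → any p L ≡ true → ∃ λ b → (elemᵇ b L ≡ true) × (p b ≡ true)
any⇒witness p (x ∷ L) e with p x in px
... | true  = x , elemᵇ-here x L , px
... | false with any⇒witness p L e
...   | b , b∈L , pb = b , elemᵇ-there x L b∈L , pb

witness⇒any : ∀ (p : ℕ → Bool) L {b} → elemᵇ b L ≡ true → p b ≡ true → any p L ≡ true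
witness⇒any p (x ∷ L) {b} b∈L pb with b ≡ᵇ x in bx
... | true rewrite sym (≡ᵇ-true⁻¹ {b} {x} bx) | pb = refl
... | false = trans (cong (p x ∨_) (witness⇒any p L b∈L pb)) (∨-zeroʳ _)

anySub : (List ℕ → Bool) → List ℕ → Bool
anySub g w = any g (subseqs w)

anySub-cons : ∀ g x xs → anySub g (x ∷ xs) ≡ (anySub (λ s → g (x ∷ s)) xs ∨ anySub g xs)
anySub-cons g x xs = trans (any-++ g (map (x ∷_) (subseqs xs)) (subseqs xs))
                           (cong (_∨ anySub g xs) (any-map g (x ∷_) (subseqs xs)))

anySub-mono : ∀ {g h : List ℕ → Bool} w → (∀ s → g s ≡ true → h s ≡ true) → anySub g w ≡ true → anySub h w ≡ true
anySub-mono w = any-mono (subseqs w)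

anySub-empty : ∀ (g : List ℕ → Bool) zs → (∀ c s → g (c ∷ s) ≡ false) → anySub g zs ≡ g []
anySub-empty g []       h = ∨-identityʳ (g [])
anySub-empty g (z ∷ zs) h =
  trans (anySub-cons g z zs)
  (trans (cong₂ _∨_ (anySub-empty (λ s → g (z ∷ s)) zs (λ c s → h z (c ∷ s))) (anySub-empty g zs h))
         (cong (_∨ g []) (h z [])))

anySub-singletons : ∀ (g : List ℕ → Bool) ys → g [] ≡ false → (∀ b c s → g (b ∷ c ∷ s) ≡ false) →
  anySub g ys ≡ any (λ b → g (b ∷ [])) ys
anySub-singletons g []       g0 g2 = trans (∨-identityʳ (g [])) g0
anySub-singletons g (y ∷ ys) g0 g2 =
  trans (anySub-cons g y ys)
  (cong₂ _∨_ (anySub-empty (λ s → g (y ∷ s)) ys (λ c s → g2 y c s)) (anySub-singletons g ys g0 g2))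

anyPair : (ℕ → ℕ → Bool) → List ℕ → Bool
anyPair h []       = false
anyPair h (y ∷ ys) = any (h y) ys ∨ anyPair h ys

anySub-pairs : ∀ (g : List ℕ → Bool) xs → g [] ≡ false → (∀ a → g (a ∷ []) ≡ false) →
  (∀ a b c s → g (a ∷ b ∷ c ∷ s) ≡ false) → anySub g xs ≡ anyPair (λ a b → g (a ∷ b ∷ [])) xs
anySub-pairs g []       g0 g1 g3 = trans (∨-identityʳ (g [])) g0
anySub-pairs g (y ∷ ys) g0 g1 g3 =
  trans (anySub-cons g y ys)
  (cong₂ _∨_ (anySub-singletons (λ s → g (y ∷ s)) ys (g1 y) (λ b c s → g3 y b c s)) (anySub-pairs g ys g0 g1 g3))

anyPair-cong : ∀ {h h' : ℕ → ℕ → Bool} L → (∀ a b → h a b ≡ h' a b) → anyPair h L ≡ anyPair h' L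
anyPair-cong []      e = refl
anyPair-cong (y ∷ L) e = cong₂ _∨_ (any-cong L (e y)) (anyPair-cong L e)

anyPair-guard : ∀ (c : Bool) (h : ℕ → ℕ → Bool) L → anyPair (λ a b → c ∧ h a b) L ≡ (c ∧ anyPair h L)
anyPair-guard true  h L       = refl
anyPair-guard false h []      = refl
anyPair-guard false h (y ∷ L) = trans (cong (_∨ anyPair (λ a b → false) L) (any-false L)) (anyPair-guard false h L)

anyPair⇒witness : ∀ h L → AllPairs _≢_ L → anyPair h L ≡ true →
  ∃ λ a → ∃ λ b → (elemᵇ a L ≡ true) × (elemᵇ b L ≡ true) × (a ≢ b) × (h a b ≡ true)
anyPair⇒witness h (y ∷ ys) (y∉ys ∷ u) e with any (h y) ys in hy
... | true with any⇒witness (h y) ys hy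
...   | b , b∈ys , hyb = y , b , elemᵇ-here y ys , elemᵇ-there y ys b∈ys , All-elemᵇ y∉ys b∈ys , hyb
anyPair⇒witness h (y ∷ ys) (y∉ys ∷ u) e | false with anyPair⇒witness h ys u e
... | a , b , a∈ , b∈ , a≢b , hab = a , b , elemᵇ-there y ys a∈ , elemᵇ-there y ys b∈ , a≢b , hab

witness⇒anyPair : ∀ h → (∀ a b → h a b ≡ h b a) → ∀ L {a b} → elemᵇ a L ≡ true → elemᵇ b L ≡ true →
  a ≢ b → h a b ≡ true → anyPair h L ≡ true
witness⇒anyPair h sym-h (y ∷ L) {a} {b} a∈ b∈ a≢b hab with a ≡ᵇ y in ay | b ≡ᵇ y in by
... | true  | true  = ⊥-elim (a≢b (trans (≡ᵇ-true⁻¹ {a} {y} ay) (sym (≡ᵇ-true⁻¹ {b} {y} by))))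
... | true  | false rewrite sym (≡ᵇ-true⁻¹ {a} {y} ay) = cong (_∨ anyPair h L) (witness⇒any (h a) L b∈ hab)
... | false | true  rewrite sym (≡ᵇ-true⁻¹ {b} {y} by) =
  cong (_∨ anyPair h L) (witness⇒any (h b) L a∈ (trans (sym-h b a) hab))
... | false | false = trans (cong (any (h y) L ∨_) (witness⇒anyPair h sym-h L a∈ b∈ a≢b hab)) (∨-zeroʳ _)

-- A local condition D M x rest, about a letter x with running maximum M before it
-- and suffix `rest` after it.
Condition : Set
Condition = ℕ → ℕ → List ℕ → Bool

runMax : ℕ → ℕ → ℕ
runMax M x = if M <ᵇ x then x else M

admissible : Condition → ℕ → List ℕ → Bool
admissible D M []       = true
admissible D M (x ∷ xs) = (not (x <ᵇ M) ∨ D M x xs) ∧ admissible D (runMax M x) xs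

matches : List (List ℕ) → List ℕ → Bool
matches T s = any (orderIso s) T

avoidsAll-anySub : ∀ T w → avoidsAll T w ≡ not (anySub (matches T) w)
avoidsAll-anySub []      w = sym (cong not (any-false (subseqs w)))
avoidsAll-anySub (τ ∷ T) w rewrite avoidsAll-anySub T w =
  trans (deMorgan (any (λ s → orderIso s τ) (subseqs w)) _)
        (cong not (sym (any-∨ (λ s → orderIso s τ) (λ s → any (orderIso s) T) (subseqs w))))
  where
  deMorgan : ∀ a b → (not a ∧ not b) ≡ not (a ∨ b)
  deMorgan true  b = refl
  deMorgan false b = refl

HeadMonotone : (List ℕ → Bool) → Set
HeadMonotone o = ∀ X X' s → X ≤ X' → o (X ∷ s) ≡ true → o (X' ∷ s) ≡ true

anySub-runMax : ∀ o → HeadMonotone o → ∀ M x xs →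
  anySub (λ s → o (runMax M x ∷ s)) xs ≡ (anySub (λ s → o (x ∷ s)) xs ∨ anySub (λ s → o (M ∷ s)) xs)
anySub-runMax o mono M x xs with M <ᵇ x in M<x
... | true  = absorb (anySub-mono xs (λ s → mono M x s (<⇒≤ (<ᵇ-true⁻¹ {M} {x} M<x))))
  where
  absorb : ∀ {a b : Bool} → (b ≡ true → a ≡ true) → a ≡ (a ∨ b)
  absorb {true}          f = refl
  absorb {false} {true}  f = f refl
  absorb {false} {false} f = refl
... | false = absorb′ (anySub-mono xs (λ s → mono x M s (<ᵇ-false⁻¹ {M} {x} M<x)))
  where
  absorb′ : ∀ {a b : Bool} → (a ≡ true → b ≡ true) → b ≡ (a ∨ b)
  absorb′ {true}  {true}  f = refl
  absorb′ {true}  {false} f = f refl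
  absorb′ {false}         f = refl

LocalChar : (List ℕ → Bool) → Condition → Set
LocalChar o D = ∀ M x xs → x ≢ M → All (_≢ x) xs → All (_≢ M) xs → AllPairs _≢_ xs →
  anySub (λ s → o (M ∷ x ∷ s)) xs ≡ ((x <ᵇ M) ∧ not (D M x xs))

runMax-fresh : ∀ M x xs → All (x ≢_) xs → All (_≢ M) xs → All (_≢ runMax M x) xs
runMax-fresh M x xs x∉xs M∉xs with M <ᵇ x
... | true  = All.map (λ x≢z z≡x → x≢z (sym z≡x)) x∉xs
... | false = M∉xs

admissible-step : ∀ a1 a2 b2 l d →
  (not (a1 ∨ a2) ∧ not ((l ∧ not d) ∨ b2)) ≡ ((not l ∨ d) ∧ (not a2 ∧ not (a1 ∨ b2)))
admissible-step false _     _ false false = refl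
admissible-step true  false _ false false = refl
admissible-step true  true  _ false false = refl
admissible-step false _     _ false true  = refl
admissible-step true  false _ false true  = refl
admissible-step true  true  _ false true  = refl
admissible-step false false _ true  false = refl
admissible-step false true  _ true  false = refl
admissible-step true  _     _ true  false = refl
admissible-step false _     _ true  true  = refl
admissible-step true  false _ true  true  = refl
admissible-step true  true  _ true  true  = refl

avoidance-local : ∀ (o : List ℕ → Bool) D → o [] ≡ false → (∀ M → o (M ∷ []) ≡ false) →
  HeadMonotone o → LocalChar o D →
  ∀ w M → AllPairs _≢_ w → All (_≢ M) w →
  (not (anySub o w) ∧ not (anySub (λ s → o (M ∷ s)) w)) ≡ admissible D M w
avoidance-local o D o0 o1 mono loc [] M u M∉w rewrite o0 | o1 M = refl
avoidance-local o D o0 o1 mono loc (x ∷ xs) M (x∉xs ∷ u) (x≢M ∷ M∉xs)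
  rewrite anySub-cons o x xs | anySub-cons (λ s → o (M ∷ s)) x xs
        | loc M x xs x≢M (All.map (λ x≢z z≡x → x≢z (sym z≡x)) x∉xs) M∉xs u
        | sym (avoidance-local o D o0 o1 mono loc xs (runMax M x) u (runMax-fresh M x xs x∉xs M∉xs))
        | anySub-runMax o mono M x xs
  = admissible-step (anySub (λ s → o (x ∷ s)) xs) (anySub o xs) (anySub (λ s → o (M ∷ s)) xs) (x <ᵇ M) (D M x xs)

-- With the virtual maximum 0 in front of a word of positive letters nothing is
-- below the maximum, so no occurrence starts at 0.
anySub-from-0 : ∀ o D → (∀ M → o (M ∷ []) ≡ false) → LocalChar o D →
  ∀ w → AllPairs _≢_ w → All (_≢ 0) w → anySub (λ s → o (0 ∷ s)) w ≡ false
anySub-from-0 o D o1 loc [] u w≢0 = trans (∨-identityʳ (o (0 ∷ []))) (o1 0)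
anySub-from-0 o D o1 loc (x ∷ xs) (x∉xs ∷ u) (x≢0 ∷ w≢0)
  rewrite anySub-cons (λ s → o (0 ∷ s)) x xs
        | loc 0 x xs x≢0 (All.map (λ x≢z z≡x → x≢z (sym z≡x)) x∉xs) w≢0 u = anySub-from-0 o D o1 loc xs u w≢0

avoidsAll⇔admissible : ∀ T D → matches T [] ≡ false → (∀ M → matches T (M ∷ []) ≡ false) →
  HeadMonotone (matches T) → LocalChar (matches T) D →
  ∀ w → AllPairs _≢_ w → All (_≢ 0) w → avoidsAll T w ≡ admissible D 0 w
avoidsAll⇔admissible T D o0 o1 mono loc w u w≢0 =
  begin
    avoidsAll T w
  ≡⟨ avoidsAll-anySub T w ⟩
    not (anySub (matches T) w)
  ≡⟨ sym (∧-identityʳ _) ⟩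
    not (anySub (matches T) w) ∧ not false
  ≡⟨ cong (λ b → not (anySub (matches T) w) ∧ not b) (sym (anySub-from-0 (matches T) D o1 loc w u w≢0)) ⟩
    not (anySub (matches T) w) ∧ not (anySub (λ s → matches T (0 ∷ s)) w)
  ≡⟨ avoidance-local (matches T) D o0 o1 mono loc w 0 u w≢0 ⟩
    admissible D 0 w
  ∎
  where open ≡-Reasoning

-- the comparison outcomes p q r of u<v, v<w, u<w admit no cycle
acyclic : Bool → Bool → Bool → Bool
acyclic p q r = not (p ∧ (q ∧ not r)) ∧ not (not p ∧ (not q ∧ r))

-- the comparisons M<x M<a M<b x<a x<b a<b of four numbers
consistent : Bool → Bool → Bool → Bool → Bool → Bool → Bool
consistent p1 p2 p3 p4 p5 p6 = acyclic p1 p4 p2 ∧ (acyclic p1 p5 p3 ∧ (acyclic p2 p6 p3 ∧ acyclic p4 p6 p5))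

acyclic-ℕ : ∀ u v w → acyclic (u <ᵇ v) (v <ᵇ w) (u <ᵇ w) ≡ true
acyclic-ℕ u v w with u <ᵇ v in uv | v <ᵇ w in vw | u <ᵇ w in uw
... | true  | true  | false =
  ⊥-elim (<-irrefl refl (<-≤-trans (<-trans (<ᵇ-true⁻¹ {u} {v} uv) (<ᵇ-true⁻¹ {v} {w} vw)) (<ᵇ-false⁻¹ {u} {w} uw)))
... | false | false | true  =
  ⊥-elim (<-irrefl refl (<-≤-trans (<ᵇ-true⁻¹ {u} {w} uw) (≤-trans (<ᵇ-false⁻¹ {v} {w} vw) (<ᵇ-false⁻¹ {u} {v} uv))))
... | true  | true  | true  = refl
... | true  | false | _     = refl
... | false | true  | _     = refl
... | false | false | false = refl

consistent-ℕ : ∀ M x a b → consistent (M <ᵇ x) (M <ᵇ a) (M <ᵇ b) (x <ᵇ a) (x <ᵇ b) (a <ᵇ b) ≡ true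
consistent-ℕ M x a b rewrite acyclic-ℕ M x a | acyclic-ℕ M x b | acyclic-ℕ M a b | acyclic-ℕ x a b = refl

matchesᵇ : List (List ℕ) → List Bool → Bool
matchesᵇ T bs = any (λ τ → zipEq bs (orderPairs τ)) T

table₁ : ∀ p1 p2 p3 p4 p5 p6 → consistent p1 p2 p3 p4 p5 p6 ≡ true →
  matchesᵇ T₁ (p1 ∷ p2 ∷ p3 ∷ p4 ∷ p5 ∷ p6 ∷ []) ≡ not p1 ∧ ((not p4 ∧ p5) ∨ (not p5 ∧ p4))
table₁ true  _     _     _     _     _     _ = refl
table₁ false false false false false _     _ = refl
table₁ false false true  false false _     ()
table₁ false true  _     false false _     ()
table₁ false false false false true  false ()
table₁ false false false false true  true  _ = refl
table₁ false false true  false true  false ()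
table₁ false false true  false true  true  _ = refl
table₁ false true  _     false true  _     ()
table₁ false false false true  false false _ = refl
table₁ false false false true  false true  ()
table₁ false false true  true  false _     ()
table₁ false true  false true  false false _ = refl
table₁ false true  false true  false true  ()
table₁ false true  true  true  false _     ()
table₁ false false false true  true  _     _ = refl
table₁ false false true  true  true  _     _ = refl
table₁ false true  false true  true  _     _ = refl
table₁ false true  true  true  true  _     _ = refl

table₂ : ∀ p1 p2 p3 p4 p5 p6 → consistent p1 p2 p3 p4 p5 p6 ≡ true →
  matchesᵇ T₂ (p1 ∷ p2 ∷ p3 ∷ p4 ∷ p5 ∷ p6 ∷ []) ≡ not p1 ∧ (p4 ∧ (p5 ∧ (not p2 ∨ not p3)))
table₂ true  _     _     _     _     _     _ = refl
table₂ false false false false false _     _ = refl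
table₂ false false true  false false _     ()
table₂ false true  _     false false _     ()
table₂ false false false false true  _     _ = refl
table₂ false false true  false true  _     _ = refl
table₂ false true  _     false true  _     ()
table₂ false false false true  false _     _ = refl
table₂ false false true  true  false _     ()
table₂ false true  false true  false _     _ = refl
table₂ false true  true  true  false _     ()
table₂ false false false true  true  false _ = refl
table₂ false false false true  true  true  _ = refl
table₂ false false true  true  true  false ()
table₂ false false true  true  true  true  _ = refl
table₂ false true  false true  true  false _ = refl
table₂ false true  false true  true  true  ()
table₂ false true  true  true  true  _     _ = refl

between : ℕ → ℕ → ℕ → Bool
between x a b = (not (x <ᵇ a) ∧ (x <ᵇ b)) ∨ (not (x <ᵇ b) ∧ (x <ᵇ a))

belowBoth : ℕ → ℕ → ℕ → ℕ → Bool
belowBoth M x a b = (x <ᵇ a) ∧ ((x <ᵇ b) ∧ (not (M <ᵇ a) ∨ not (M <ᵇ b)))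

matches-T₁ : ∀ M x a b → matches T₁ (M ∷ x ∷ a ∷ b ∷ []) ≡ not (M <ᵇ x) ∧ between x a b
matches-T₁ M x a b = table₁ (M <ᵇ x) (M <ᵇ a) (M <ᵇ b) (x <ᵇ a) (x <ᵇ b) (a <ᵇ b) (consistent-ℕ M x a b)

matches-T₂ : ∀ M x a b → matches T₂ (M ∷ x ∷ a ∷ b ∷ []) ≡ not (M <ᵇ x) ∧ belowBoth M x a b
matches-T₂ M x a b = table₂ (M <ᵇ x) (M <ᵇ a) (M <ᵇ b) (x <ᵇ a) (x <ᵇ b) (a <ᵇ b) (consistent-ℕ M x a b)

between-sym : ∀ x a b → between x a b ≡ between x b a
between-sym x a b = ∨-comm (not (x <ᵇ a) ∧ (x <ᵇ b)) (not (x <ᵇ b) ∧ (x <ᵇ a))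

belowBoth-sym : ∀ M x a b → belowBoth M x a b ≡ belowBoth M x b a
belowBoth-sym M x a b with x <ᵇ a | x <ᵇ b
... | true  | true  = ∨-comm (not (M <ᵇ a)) (not (M <ᵇ b))
... | true  | false = refl
... | false | true  = refl
... | false | false = refl

<ᵇ-raise : ∀ {X X' y} → X ≤ X' → (X <ᵇ y) ≡ false → (X' <ᵇ y) ≡ false
<ᵇ-raise {X} {X'} {y} X≤X' e = <ᵇ-false (≤-trans (<ᵇ-false⁻¹ {X} {y} e) X≤X')

matches-T₁-mono : HeadMonotone (matches T₁)
matches-T₁-mono X X' (y ∷ a ∷ b ∷ []) X≤X' e
  rewrite matches-T₁ X' y a b with X <ᵇ y in Xy | trans (sym (matches-T₁ X y a b)) e
... | false | e′ rewrite <ᵇ-raise {X} {X'} {y} X≤X' Xy = e′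

matches-T₂-mono : HeadMonotone (matches T₂)
matches-T₂-mono X X' (y ∷ a ∷ b ∷ []) X≤X' e
  rewrite matches-T₂ X' y a b with X <ᵇ y in Xy | X <ᵇ a in Xa | X <ᵇ b in Xb | trans (sym (matches-T₂ X y a b)) e
... | false | false | _     | e′ rewrite <ᵇ-raise {X} {X'} {y} X≤X' Xy | <ᵇ-raise {X} {X'} {a} X≤X' Xa = e′
... | false | true  | false | e′ rewrite <ᵇ-raise {X} {X'} {y} X≤X' Xy | <ᵇ-raise {X} {X'} {b} X≤X' Xb
                                     | ∨-zeroʳ (not (X' <ᵇ a)) = e′
... | false | true  | true  | e′ = ⊥-elim (true≢false (trans (sym e′) (∧-zeroʳ-nested (y <ᵇ a) (y <ᵇ b))))
  where
  ∧-zeroʳ-nested : ∀ p q → (p ∧ (q ∧ false)) ≡ false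
  ∧-zeroʳ-nested p q = trans (cong (p ∧_) (∧-zeroʳ q)) (∧-zeroʳ p)

D₁ : Condition
D₁ M x L = all (x <ᵇ_) L ∨ all (_<ᵇ x) L

D₂ : Condition
D₂ M x L = all (λ c → not ((x <ᵇ c) ∧ (c <ᵇ M)) ∨ all (λ b → (b ≡ᵇ c) ∨ not (x <ᵇ b)) L) L

SetInvariant : Condition → Set
SetInvariant D = ∀ M x L L' → (∀ z → elemᵇ z L ≡ elemᵇ z L') → D M x L ≡ D M x L'

D₁-setInvariant : SetInvariant D₁
D₁-setInvariant M x L L' e = cong₂ _∨_ (all-sameElems _ L L' e) (all-sameElems _ L L' e)

D₂-setInvariant : SetInvariant D₂
D₂-setInvariant M x L L' e =
  trans (all-cong L (λ c → cong (not ((x <ᵇ c) ∧ (c <ᵇ M)) ∨_) (all-sameElems _ L L' e)))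
        (all-sameElems _ L L' e)

between-pair⇔¬D₁ : ∀ M x L → All (_≢ x) L → AllPairs _≢_ L → anyPair (between x) L ≡ not (D₁ M x L)
between-pair⇔¬D₁ M x L x∉L u = bool-ext fwd bwd
  where
  fwd : anyPair (between x) L ≡ true → not (D₁ M x L) ≡ true
  fwd e with anyPair⇒witness (between x) L u e
  ... | a , b , a∈ , b∈ , _ , _ with x <ᵇ a in xa | x <ᵇ b in xb
  ...   | false | true
    rewrite witness⇒all-false (x <ᵇ_) L a∈ xa | witness⇒all-false (_<ᵇ x) L b∈ (<ᵇ-false (<⇒≤ (<ᵇ-true⁻¹ {x} {b} xb))) = refl
  ...   | true  | false
    rewrite witness⇒all-false (x <ᵇ_) L b∈ xb | witness⇒all-false (_<ᵇ x) L a∈ (<ᵇ-false (<⇒≤ (<ᵇ-true⁻¹ {x} {a} xa))) = refl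
  bwd : not (D₁ M x L) ≡ true → anyPair (between x) L ≡ true
  bwd e with all-false⇒witness {x <ᵇ_} {L} (∨-conicalˡ _ _ (not-true e))
           | all-false⇒witness {_<ᵇ x} {L} (∨-conicalʳ _ _ (not-true e))
  ... | a , a∈ , xa | b , b∈ , bx = witness⇒anyPair (between x) (between-sym x) L a∈ b∈ a≢b between-xab
    where
    a≤x = <ᵇ-false⁻¹ {x} {a} xa
    x≤b = <ᵇ-false⁻¹ {b} {x} bx
    b≢x = All-elemᵇ x∉L b∈
    x<b = ≤∧≢⇒< x≤b (λ x≡b → b≢x (sym x≡b))
    a≢b : a ≢ b
    a≢b refl = b≢x (≤-antisym a≤x x≤b)
    between-xab : between x a b ≡ true
    between-xab rewrite xa | <ᵇ-true x<b = refl

belowBoth-pair⇔¬D₂ : ∀ M x L → All (_≢ M) L → AllPairs _≢_ L → anyPair (belowBoth M x) L ≡ not (D₂ M x L)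
belowBoth-pair⇔¬D₂ M x L M∉L u = bool-ext fwd bwd
  where
  alone : ℕ → ℕ → Bool
  alone c b = (b ≡ᵇ c) ∨ not (x <ᵇ b)
  refute : ∀ {c b} → elemᵇ c L ≡ true → elemᵇ b L ≡ true → b ≢ c →
    (x <ᵇ c) ≡ true → (x <ᵇ b) ≡ true → (M <ᵇ c) ≡ false → not (D₂ M x L) ≡ true
  refute {c} {b} c∈ b∈ b≢c xc xb Mc =
    cong not (witness⇒all-false (λ c' → not ((x <ᵇ c') ∧ (c' <ᵇ M)) ∨ all (alone c') L) L c∈
      (trans (cong₂ (λ p q → not (p ∧ q) ∨ all (alone c) L) xc (<ᵇ-true (≤∧≢⇒< (<ᵇ-false⁻¹ {M} {c} Mc) (All-elemᵇ M∉L c∈))))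
             (witness⇒all-false (alone c) L b∈ (cong₂ _∨_ (≡ᵇ-false b≢c) (cong not xb)))))
  fwd : anyPair (belowBoth M x) L ≡ true → not (D₂ M x L) ≡ true
  fwd e with anyPair⇒witness (belowBoth M x) L u e
  ... | a , b , a∈ , b∈ , a≢b , _ with x <ᵇ a in xa | x <ᵇ b in xb | M <ᵇ a in Ma | M <ᵇ b in Mb
  ...   | true | true | false | _     = refute a∈ b∈ (λ b≡a → a≢b (sym b≡a)) xa xb Ma
  ...   | true | true | true  | false = refute b∈ a∈ a≢b xb xa Mb
  bwd : not (D₂ M x L) ≡ true → anyPair (belowBoth M x) L ≡ true
  bwd e with all-false⇒witness {λ c' → not ((x <ᵇ c') ∧ (c' <ᵇ M)) ∨ all (alone c') L} {L} (not-true e)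
  ... | c , c∈ , fc with all-false⇒witness {alone c} {L} (∨-conicalʳ _ _ fc)
  ...   | b , b∈ , fb =
    witness⇒anyPair (belowBoth M x) (belowBoth-sym M x) L c∈ b∈ (λ c≡b → ≡ᵇ-false⁻¹ (∨-conicalˡ _ _ fb) (sym c≡b)) belowBoth-xcb
    where
    x<c<M = not-false (∨-conicalˡ _ _ fc)
    belowBoth-xcb : belowBoth M x c b ≡ true
    belowBoth-xcb rewrite ∧-conicalˡ (x <ᵇ c) (c <ᵇ M) x<c<M | not-false (∨-conicalʳ (b ≡ᵇ c) _ fb)
                        | <ᵇ-false {M} {c} (<⇒≤ (<ᵇ-true⁻¹ {c} {M} (∧-conicalʳ (x <ᵇ c) _ x<c<M))) = refl

localChar₁ : LocalChar (matches T₁) D₁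
localChar₁ M x xs x≢M x∉xs M∉xs u =
  begin
    anySub (λ s → matches T₁ (M ∷ x ∷ s)) xs
  ≡⟨ anySub-pairs (λ s → matches T₁ (M ∷ x ∷ s)) xs refl (λ a → refl) (λ a b c s → refl) ⟩
    anyPair (λ a b → matches T₁ (M ∷ x ∷ a ∷ b ∷ [])) xs
  ≡⟨ anyPair-cong xs (matches-T₁ M x) ⟩
    anyPair (λ a b → not (M <ᵇ x) ∧ between x a b) xs
  ≡⟨ anyPair-guard (not (M <ᵇ x)) (between x) xs ⟩
    not (M <ᵇ x) ∧ anyPair (between x) xs
  ≡⟨ cong₂ _∧_ (not-<ᵇ-flip x M x≢M) (between-pair⇔¬D₁ M x xs x∉xs u) ⟩
    (x <ᵇ M) ∧ not (D₁ M x xs)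
  ∎
  where open ≡-Reasoning

localChar₂ : LocalChar (matches T₂) D₂
localChar₂ M x xs x≢M x∉xs M∉xs u =
  begin
    anySub (λ s → matches T₂ (M ∷ x ∷ s)) xs
  ≡⟨ anySub-pairs (λ s → matches T₂ (M ∷ x ∷ s)) xs refl (λ a → refl) (λ a b c s → refl) ⟩
    anyPair (λ a b → matches T₂ (M ∷ x ∷ a ∷ b ∷ [])) xs
  ≡⟨ anyPair-cong xs (matches-T₂ M x) ⟩
    anyPair (λ a b → not (M <ᵇ x) ∧ belowBoth M x a b) xs
  ≡⟨ anyPair-guard (not (M <ᵇ x)) (belowBoth M x) xs ⟩
    not (M <ᵇ x) ∧ anyPair (belowBoth M x) xs
  ≡⟨ cong₂ _∧_ (not-<ᵇ-flip x M x≢M) (belowBoth-pair⇔¬D₂ M x xs M∉xs u) ⟩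
    (x <ᵇ M) ∧ not (D₂ M x xs)
  ∎
  where open ≡-Reasoning

avoids-T₁ : ∀ w → AllPairs _≢_ w → All (_≢ 0) w → avoidsAll T₁ w ≡ admissible D₁ 0 w
avoids-T₁ = avoidsAll⇔admissible T₁ D₁ refl (λ M → refl) matches-T₁-mono localChar₁

avoids-T₂ : ∀ w → AllPairs _≢_ w → All (_≢ 0) w → avoidsAll T₂ w ≡ admissible D₂ 0 w
avoids-T₂ = avoidsAll⇔admissible T₂ D₂ refl (λ M → refl) matches-T₂-mono localChar₂

sumOver-cong : ∀ L {f g : ℕ → ℕ} → (∀ a → f a ≡ g a) → sumOver L f ≡ sumOver L g
sumOver-cong []      e = refl
sumOver-cong (x ∷ L) e = cong₂ _+_ (e x) (sumOver-cong L e)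

sumOver-+ : ∀ L (f g : ℕ → ℕ) → sumOver L (λ a → f a + g a) ≡ sumOver L f + sumOver L g
sumOver-+ []      f g = refl
sumOver-+ (x ∷ L) f g rewrite sumOver-+ L f g = interchange (f x) (g x) (sumOver L f) (sumOver L g)
  where
  open +-*-Solver
  interchange : ∀ a b c d → (a + b) + (c + d) ≡ (a + c) + (b + d)
  interchange = solve 4 (λ a b c d → (a :+ b) :+ (c :+ d) := (a :+ c) :+ (b :+ d)) refl

countᵇ-concatMap : ∀ (p : List ℕ → Bool) (W : List (List ℕ)) L →
  countᵇ p (concatMap (λ a → map (a ∷_) W) L) ≡ sumOver L (λ a → countᵇ (λ w → p (a ∷ w)) W)
countᵇ-concatMap p W []      = refl
countᵇ-concatMap p W (a ∷ L) =
  trans (countᵇ-++ p (map (a ∷_) W) (concatMap (λ a → map (a ∷_) W) L))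
        (cong₂ _+_ (countᵇ-map p (a ∷_) W) (countᵇ-concatMap p W L))

sumOver-guarded : ∀ L (v : ℕ → Bool) (c : ℕ → ℕ) C → (∀ a → v a ≡ true → c a ≡ C) →
  sumOver L (λ a → if v a then c a else 0) ≡ countᵇ v L * C
sumOver-guarded []      v c C h = refl
sumOver-guarded (x ∷ L) v c C h with v x in vx
... | true  = cong₂ _+_ (h x vx) (sumOver-guarded L v c C h)
... | false = sumOver-guarded L v c C h

sumOver-guarded-zero : ∀ L (v : ℕ → Bool) (c : ℕ → ℕ) → countᵇ v L ≡ 0 → sumOver L (λ a → if v a then c a else 0) ≡ 0
sumOver-guarded-zero []      v c e = refl
sumOver-guarded-zero (x ∷ L) v c e with v x
... | false = sumOver-guarded-zero L v c e

sumOver-guarded-eq : ∀ L (v₁ v₂ : ℕ → Bool) (c₁ c₂ : ℕ → ℕ) →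
  (∀ a b → v₁ a ≡ true → v₂ b ≡ true → c₁ a ≡ c₂ b) → countᵇ v₁ L ≡ countᵇ v₂ L →
  sumOver L (λ a → if v₁ a then c₁ a else 0) ≡ sumOver L (λ a → if v₂ a then c₂ a else 0)
sumOver-guarded-eq L v₁ v₂ c₁ c₂ h same with countᵇ v₁ L in e₁
... | zero = trans (sumOver-guarded-zero L v₁ c₁ e₁) (sym (sumOver-guarded-zero L v₂ c₂ (sym same)))
... | suc m with countᵇ-suc v₁ L e₁ | countᵇ-suc v₂ L (sym same)
...   | a₀ , va₀ | b₀ , vb₀ =
  trans (sumOver-guarded L v₁ c₁ (c₂ b₀) (λ a va → h a b₀ va vb₀))
  (trans (cong (_* c₂ b₀) (trans e₁ same))
  (sym (sumOver-guarded L v₂ c₂ (c₂ b₀) (λ b vb → trans (sym (h a₀ b va₀ vb)) (h a₀ b₀ va₀ vb₀)))))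

-- The generating process.  A state is (R, M): the sorted list R of unused
-- letters and the running maximum M.

remove : ℕ → List ℕ → List ℕ
remove a = select (λ r → not (a ≡ᵇ r))

above : ℕ → List ℕ → List ℕ
above M = select (M <ᵇ_)

belowCount : ℕ → List ℕ → ℕ
belowCount M = countᵇ (λ r → not (M <ᵇ r))

generates : Condition → List ℕ → ℕ → List ℕ → Bool
generates D R M []       = null R
generates D R M (x ∷ xs) = elemᵇ x R ∧ ((not (x <ᵇ M) ∨ D M x xs) ∧ generates D (remove x R) (runMax M x) xs)

shape : ℕ → List ℕ → List ℕ
shape M []       = []
shape M (x ∷ xs) = if M <ᵇ x then x ∷ shape x xs else 0 ∷ shape M xs

elemᵇ-remove : ∀ a z L → elemᵇ z (remove a L) ≡ not (a ≡ᵇ z) ∧ elemᵇ z L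
elemᵇ-remove a z L = elemᵇ-select (λ r → not (a ≡ᵇ r)) z L

remove-fresh : ∀ a R → All (_≢ a) (remove a R)
remove-fresh a R = All.map (λ {x} e x≡a → true≢false (trans (sym e) (cong not (trans (cong (a ≡ᵇ_) x≡a) (≡ᵇ-refl a)))))
                           (All-select-pred (λ r → not (a ≡ᵇ r)) R)

arranges : List ℕ → List ℕ → Bool
arranges R []       = null R
arranges R (x ∷ xs) = elemᵇ x R ∧ arranges (remove x R) xs

generates-split : ∀ D R M w → generates D R M w ≡ (arranges R w ∧ admissible D M w)
generates-split D R M [] = sym (∧-identityʳ (null R))
generates-split D R M (x ∷ xs) rewrite generates-split D (remove x R) (runMax M x) xs =
  regroup (elemᵇ x R) (not (x <ᵇ M) ∨ D M x xs) (arranges (remove x R) xs) (admissible D (runMax M x) xs)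
  where
  regroup : ∀ a b c d → (a ∧ (b ∧ (c ∧ d))) ≡ ((a ∧ c) ∧ (b ∧ d))
  regroup true  true  c d = refl
  regroup true  false c d = sym (∧-zeroʳ c)
  regroup false b     c d = refl

arranges⇒sameElems : ∀ R w → arranges R w ≡ true → ∀ z → elemᵇ z w ≡ elemᵇ z R
arranges⇒sameElems [] [] e z = refl
arranges⇒sameElems R (x ∷ xs) e z with elemᵇ x R in x∈R
... | true with z ≡ᵇ x in zx
...   | true  = sym (trans (cong (λ y → elemᵇ y R) (≡ᵇ-true⁻¹ {z} {x} zx)) x∈R)
...   | false = trans (arranges⇒sameElems (remove x R) xs e z)
                      (trans (elemᵇ-remove x z R) (cong (λ b → not b ∧ elemᵇ z R) (trans (≡ᵇ-sym x z) zx)))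

generates⇒sameElems : ∀ D R M w → generates D R M w ≡ true → ∀ z → elemᵇ z w ≡ elemᵇ z R
generates⇒sameElems D R M w e = arranges⇒sameElems R w (∧-conicalˡ _ _ (trans (sym (generates-split D R M w)) e))

elemᵇ-above-min : ∀ {y R} → All (y <_) R → elemᵇ y R ≡ false
elemᵇ-above-min [] = refl
elemᵇ-above-min {y} {r ∷ R} (y<r ∷ ps) rewrite ≡ᵇ-false {y} {r} (λ y≡r → <-irrefl y≡r y<r) = elemᵇ-above-min ps

elemᵇ-sorted-head : ∀ {y r L} → All (y <_) L → elemᵇ r (y ∷ L) ≡ true → y ≤ r
elemᵇ-sorted-head {y} {r} y<L e with r ≡ᵇ y in ry
... | true  = ≤-reflexive (sym (≡ᵇ-true⁻¹ ry))
... | false = <⇒≤ (All-elemᵇ y<L e)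

⊆-drop-smaller : ∀ {y L R'} → All (y <_) R' → All (λ z → elemᵇ z (y ∷ L) ≡ true) R' → All (λ z → elemᵇ z L ≡ true) R'
⊆-drop-smaller []           []       = []
⊆-drop-smaller {y} {L} (y<z ∷ y<zs) (e ∷ es) = elemᵇ-tail {y} {_} {L} (λ z≡y → <-irrefl (sym z≡y) y<z) e ∷ ⊆-drop-smaller {y} {L} y<zs es

countᵇ-restrict : ∀ (p : ℕ → Bool) L R → AllPairs _<_ L → AllPairs _<_ R → All (λ r → elemᵇ r L ≡ true) R →
  countᵇ (λ a → elemᵇ a R ∧ p a) L ≡ countᵇ p R
countᵇ-restrict p [] [] sL sR R⊆L = refl
countᵇ-restrict p [] (r ∷ R) sL sR (() ∷ R⊆L)
countᵇ-restrict p (y ∷ L) [] sL sR R⊆L = countᵇ-false (y ∷ L)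
countᵇ-restrict p (y ∷ L) (r ∷ R) (y<L ∷ sL) (r<R ∷ sR) (r∈ ∷ R⊆L) with <-cmp r y
... | tri< r<y _ _ = ⊥-elim (<-irrefl refl (<-≤-trans r<y (elemᵇ-sorted-head y<L r∈)))
... | tri> _ _ y<r rewrite elemᵇ-above-min {y} {r ∷ R} (y<r ∷ All.map (<-trans y<r) r<R) =
  countᵇ-restrict p L (r ∷ R) sL (r<R ∷ sR) (⊆-drop-smaller {y} {L} (y<r ∷ All.map (<-trans y<r) r<R) (r∈ ∷ R⊆L))
... | tri≈ _ refl _ rewrite ≡ᵇ-refl r = cong (λ c → if p r then suc c else c) tail-eq
  where
  tail-eq : countᵇ (λ a → elemᵇ a (r ∷ R) ∧ p a) L ≡ countᵇ p R
  tail-eq = trans (countᵇ-cong (All.map (λ {a} r<a → cong (λ b → (b ∨ elemᵇ a R) ∧ p a) (≡ᵇ-false (λ a≡r → <-irrefl (sym a≡r) r<a))) y<L))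
                  (countᵇ-restrict p L R sL sR (⊆-drop-smaller {r} {L} r<R R⊆L))

countᵇ-single : ∀ (p : ℕ → Bool) a R → AllPairs _≢_ R → elemᵇ a R ≡ true → p a ≡ true →
  countᵇ (λ r → p r ∧ (a ≡ᵇ r)) R ≡ 1
countᵇ-single p a (x ∷ R) (x∉R ∷ u) a∈ pa with a ≡ᵇ x in ax
... | false rewrite ∧-zeroʳ (p x) = countᵇ-single p a R u a∈ pa
... | true rewrite sym (≡ᵇ-true⁻¹ {a} {x} ax) | pa =
  cong suc (trans (countᵇ-cong (All.map (λ {r} a≢r → trans (cong (p r ∧_) (≡ᵇ-false a≢r)) (∧-zeroʳ _)) x∉R)) (countᵇ-false R))

sorted⇒distinct : ∀ {L} → AllPairs _<_ L → AllPairs _≢_ L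
sorted⇒distinct []       = []
sorted⇒distinct (a ∷ s) = All.map <⇒≢ a ∷ sorted⇒distinct s

above-up : ∀ M a R → (M <ᵇ a) ≡ true → above a (remove a R) ≡ select (a <ᵇ_) (above M R)
above-up M a R M<a =
  trans (select-select (λ r → not (a ≡ᵇ r)) (a <ᵇ_) R)
  (trans (select-cong R pointwise) (sym (select-select (M <ᵇ_) (a <ᵇ_) R)))
  where
  pointwise : ∀ r → (not (a ≡ᵇ r) ∧ (a <ᵇ r)) ≡ ((M <ᵇ r) ∧ (a <ᵇ r))
  pointwise r with a <ᵇ r in a<r
  ... | true rewrite ≡ᵇ-false {a} {r} (<⇒≢ (<ᵇ-true⁻¹ a<r)) =
    sym (trans (∧-identityʳ _) (<ᵇ-true (<-trans (<ᵇ-true⁻¹ {M} {a} M<a) (<ᵇ-true⁻¹ {a} {r} a<r))))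
  ... | false = trans (∧-zeroʳ _) (sym (∧-zeroʳ _))

below-up : ∀ M a R → (M <ᵇ a) ≡ true → belowCount a (remove a R) ≡ countᵇ (_<ᵇ a) (above M R) + belowCount M R
below-up M a R M<ᵇa =
  trans (countᵇ-select (λ r → not (a ≡ᵇ r)) (λ r → not (a <ᵇ r)) R)
  (trans (countᵇ-split _ (M <ᵇ_) R)
  (cong₂ _+_ (trans (countᵇ-cong′ R between-M-a) (sym (countᵇ-select (M <ᵇ_) (_<ᵇ a) R))) (countᵇ-cong′ R below-M)))
  where
  M<a = <ᵇ-true⁻¹ {M} {a} M<ᵇa
  between-M-a : ∀ r → ((not (a ≡ᵇ r) ∧ not (a <ᵇ r)) ∧ (M <ᵇ r)) ≡ ((M <ᵇ r) ∧ (r <ᵇ a))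
  between-M-a r with <-cmp r a
  ... | tri< r<a _ _ rewrite ≡ᵇ-false {a} {r} (λ a≡r → <-irrefl (sym a≡r) r<a) | <ᵇ-false {a} {r} (<⇒≤ r<a) | <ᵇ-true r<a =
    sym (∧-identityʳ _)
  ... | tri≈ _ refl _ rewrite ≡ᵇ-refl r | M<ᵇa | <ᵇ-false {r} {r} ≤-refl = refl
  ... | tri> _ _ a<r rewrite <ᵇ-true a<r | <ᵇ-false {r} {a} (<⇒≤ a<r) =
    trans (cong (_∧ (M <ᵇ r)) (∧-zeroʳ _)) (sym (∧-zeroʳ _))
  below-M : ∀ r → ((not (a ≡ᵇ r) ∧ not (a <ᵇ r)) ∧ not (M <ᵇ r)) ≡ not (M <ᵇ r)
  below-M r with M <ᵇ r in M<r
  ... | true = ∧-zeroʳ _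
  ... | false rewrite ≡ᵇ-false {a} {r} (λ a≡r → <-irrefl refl (≤-<-trans (subst (_≤ M) (sym a≡r) (<ᵇ-false⁻¹ {M} {r} M<r)) M<a))
                    | <ᵇ-false {a} {r} (<⇒≤ (≤-<-trans (<ᵇ-false⁻¹ {M} {r} M<r) M<a)) = refl

elemᵇ-above : ∀ M a R R′ → above M R ≡ above M R′ → (M <ᵇ a) ≡ true → elemᵇ a R ≡ elemᵇ a R′
elemᵇ-above M a R R′ same M<a =
  begin
    elemᵇ a R             ≡⟨ cong (_∧ elemᵇ a R) (sym M<a) ⟩
    (M <ᵇ a) ∧ elemᵇ a R   ≡⟨ sym (elemᵇ-select (M <ᵇ_) a R) ⟩
    elemᵇ a (above M R)   ≡⟨ cong (elemᵇ a) same ⟩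
    elemᵇ a (above M R′)  ≡⟨ elemᵇ-select (M <ᵇ_) a R′ ⟩
    (M <ᵇ a) ∧ elemᵇ a R′  ≡⟨ cong (_∧ elemᵇ a R′) M<a ⟩
    elemᵇ a R′
  ∎
  where open ≡-Reasoning

above-down : ∀ M a R → (M <ᵇ a) ≡ false → above M (remove a R) ≡ above M R
above-down M a R M≮a = trans (select-select (λ r → not (a ≡ᵇ r)) (M <ᵇ_) R) (select-cong R pointwise)
  where
  pointwise : ∀ r → (not (a ≡ᵇ r) ∧ (M <ᵇ r)) ≡ (M <ᵇ r)
  pointwise r with M <ᵇ r in M<r
  ... | false = ∧-zeroʳ _
  ... | true rewrite ≡ᵇ-false {a} {r} (λ a≡r → <-irrefl refl (≤-<-trans (subst (_≤ M) a≡r (<ᵇ-false⁻¹ {M} {a} M≮a)) (<ᵇ-true⁻¹ M<r))) = refl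

below-down : ∀ M a R → AllPairs _≢_ R → elemᵇ a R ≡ true → (M <ᵇ a) ≡ false →
  belowCount M R ≡ suc (belowCount M (remove a R))
below-down M a R u a∈ M≮a =
  trans (countᵇ-split (λ r → not (M <ᵇ r)) (a ≡ᵇ_) R)
  (cong₂ _+_ (countᵇ-single (λ r → not (M <ᵇ r)) a R u a∈ (cong not M≮a))
    (trans (countᵇ-cong′ R (λ r → ∧-comm (not (M <ᵇ r)) (not (a ≡ᵇ r))))
           (sym (countᵇ-select (λ r → not (a ≡ᵇ r)) (λ r → not (M <ᵇ r)) R))))

null-split : ∀ M R → null R ≡ (null (above M R) ∧ (belowCount M R ≡ᵇ 0))
null-split M []      = refl
null-split M (x ∷ R) with M <ᵇ x
... | true  = refl
... | false = sym (∧-zeroʳ _)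

oneTo-sorted : ∀ n → AllPairs _<_ (oneTo n)
oneTo-sorted n = AllPairsP.map⁺ (AllPairsP.applyUpTo⁺₁ (λ x → x) n (λ i<j _ → s≤s i<j))

descent : Condition → List ℕ → ℕ → ℕ → Bool
descent D R M a = not (M <ᵇ a) ∧ (elemᵇ a R ∧ D M a (remove a R))

-- the number of descents when the letters above M are A and b letters are below M
choices : List ℕ → ℕ → ℕ
choices A zero          = 0
choices A (suc zero)    = 1
choices A (suc (suc b)) = if null A then 2 else 1

CountsDescents : Condition → Set
CountsDescents D = ∀ M R → AllPairs _<_ R → All (_≢ M) R →
  countᵇ (λ a → not (M <ᵇ a) ∧ D M a (remove a R)) R ≡ choices (above M R) (belowCount M R)

descent⇒ : ∀ D R M a → descent D R M a ≡ true → ((M <ᵇ a) ≡ false) × (elemᵇ a R ≡ true)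
descent⇒ D R M a e with M <ᵇ a | elemᵇ a R
... | false | true = refl , refl

module Completions (n : ℕ) where

  completions : Condition → List ℕ → ℕ → (List ℕ → Bool) → ℕ → ℕ
  completions D R M Q k = countᵇ (λ w → generates D R M w ∧ Q (shape M w)) (words n k)

  startingWith : Condition → List ℕ → ℕ → (List ℕ → Bool) → ℕ → ℕ → ℕ
  startingWith D R M Q k a = countᵇ (λ w → generates D R M (a ∷ w) ∧ Q (shape M (a ∷ w))) (words n k)

  completions-suc : ∀ D R M Q k → completions D R M Q (suc k) ≡ sumOver (oneTo n) (startingWith D R M Q k)
  completions-suc D R M Q k = countᵇ-concatMap (λ w → generates D R M w ∧ Q (shape M w)) (words n k) (oneTo n)

  startingWith-max : ∀ D R M Q k a → (M <ᵇ a) ≡ true →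
    startingWith D R M Q k a ≡ (if elemᵇ a R then completions D (remove a R) a (λ m → Q (a ∷ m)) k else 0)
  startingWith-max D R M Q k a M<a =
    trans (countᵇ-cong′ (words n k) pointwise)
          (countᵇ-guard (elemᵇ a R) (λ w → generates D (remove a R) a w ∧ Q (a ∷ shape a w)) (words n k))
    where
    a≮M : (a <ᵇ M) ≡ false
    a≮M = <ᵇ-false {a} {M} (<⇒≤ (<ᵇ-true⁻¹ {M} {a} M<a))
    pointwise : ∀ w → (generates D R M (a ∷ w) ∧ Q (shape M (a ∷ w)))
                      ≡ (elemᵇ a R ∧ (generates D (remove a R) a w ∧ Q (a ∷ shape a w)))
    pointwise w rewrite M<a | a≮M = ∧-assoc (elemᵇ a R) (generates D (remove a R) a w) (Q (a ∷ shape a w))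

  -- a non-maximum a must satisfy D (which only depends on the remaining letters),
  -- leads to the state (R - a, M) and records 0 in the shape
  startingWith-descent : ∀ D R M Q k a → SetInvariant D → (M <ᵇ a) ≡ false → (elemᵇ a R ≡ true → a ≢ M) →
    startingWith D R M Q k a ≡ (if elemᵇ a R ∧ D M a (remove a R) then completions D (remove a R) M (λ m → Q (0 ∷ m)) k else 0)
  startingWith-descent D R M Q k a inv M≮a a≢M =
    trans (countᵇ-cong′ (words n k) pointwise)
          (countᵇ-guard (elemᵇ a R ∧ D M a (remove a R)) (λ w → generates D (remove a R) M w ∧ Q (0 ∷ shape M w)) (words n k))
    where
    pointwise : ∀ w → (generates D R M (a ∷ w) ∧ Q (shape M (a ∷ w)))
                      ≡ ((elemᵇ a R ∧ D M a (remove a R)) ∧ (generates D (remove a R) M w ∧ Q (0 ∷ shape M w)))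
    pointwise w rewrite M≮a with elemᵇ a R in a∈R
    ... | false = refl
    ... | true with generates D (remove a R) M w in gen
    ...   | false rewrite ∧-comm (not (a <ᵇ M) ∨ D M a w) false | ∧-comm (D M a (remove a R)) false = refl
    ...   | true rewrite <ᵇ-true (≤∧≢⇒< (<ᵇ-false⁻¹ M≮a) (a≢M refl))
                       | inv M a w (remove a R) (generates⇒sameElems D (remove a R) M w gen) =
      cong (_∧ Q (0 ∷ shape M w)) (∧-comm (D M a (remove a R)) true)

  maxPart : Condition → List ℕ → ℕ → (List ℕ → Bool) → ℕ → ℕ → ℕ
  maxPart D R M Q k a = if M <ᵇ a then (if elemᵇ a R then completions D (remove a R) a (λ m → Q (a ∷ m)) k else 0) else 0

  descentPart : Condition → List ℕ → ℕ → (List ℕ → Bool) → ℕ → ℕ → ℕ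
  descentPart D R M Q k a = if descent D R M a then completions D (remove a R) M (λ m → Q (0 ∷ m)) k else 0

  startingWith-split : ∀ D → SetInvariant D → ∀ R M Q k → All (_≢ M) R → ∀ a →
    startingWith D R M Q k a ≡ maxPart D R M Q k a + descentPart D R M Q k a
  startingWith-split D inv R M Q k M∉R a = by-cases (M <ᵇ a) refl
    where
    by-cases : ∀ b → (M <ᵇ a) ≡ b → startingWith D R M Q k a ≡ maxPart D R M Q k a + descentPart D R M Q k a
    by-cases true  e rewrite startingWith-max D R M Q k a e | e = sym (+-identityʳ _)
    by-cases false e rewrite startingWith-descent D R M Q k a inv e (All-elemᵇ M∉R) | e = refl

  Valid : List ℕ → ℕ → Set
  Valid R M = AllPairs _<_ R × All (λ r → elemᵇ r (oneTo n) ≡ true) R × All (_≢ M) R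

  valid-max : ∀ {R M} a → Valid R M → Valid (remove a R) a
  valid-max {R} a (s , r∈ , _) = AllPairs-select _ s , All-select _ r∈ , remove-fresh a R

  valid-descent : ∀ {R M} a → Valid R M → Valid (remove a R) M
  valid-descent a (s , r∈ , M∉R) = AllPairs-select _ s , All-select _ r∈ , All-select _ M∉R

  descents : ∀ D → CountsDescents D → ∀ R M → Valid R M →
    countᵇ (descent D R M) (oneTo n) ≡ choices (above M R) (belowCount M R)
  descents D count R M (s , R⊆ , M∉R) =
    trans (countᵇ-cong′ (oneTo n) reorder)
    (trans (countᵇ-restrict (λ a → not (M <ᵇ a) ∧ D M a (remove a R)) (oneTo n) R (oneTo-sorted n) s R⊆)
           (count M R s M∉R))
    where
    reorder : ∀ a → descent D R M a ≡ (elemᵇ a R ∧ (not (M <ᵇ a) ∧ D M a (remove a R)))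
    reorder a with not (M <ᵇ a) | elemᵇ a R
    ... | true  | _ = refl
    ... | false | b = sym (∧-zeroʳ b)

module Transfer (n : ℕ) (D D′ : Condition) (inv : SetInvariant D) (inv′ : SetInvariant D′)
                (count : CountsDescents D) (count′ : CountsDescents D′) where
  open Completions n

  transfer : ∀ k R R′ M Q → Valid R M → Valid R′ M → above M R ≡ above M R′ → belowCount M R ≡ belowCount M R′ →
    completions D R M Q k ≡ completions D′ R′ M Q k
  transfer zero R R′ M Q v v′ same-above same-below
    rewrite null-split M R | null-split M R′ | same-above | same-below = refl
  transfer (suc k) R R′ M Q v v′ same-above same-below =
    begin
      completions D R M Q (suc k)
    ≡⟨ completions-suc D R M Q k ⟩
      sumOver (oneTo n) (startingWith D R M Q k)
    ≡⟨ sumOver-cong (oneTo n) (startingWith-split D inv R M Q k (proj₂ (proj₂ v))) ⟩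
      sumOver (oneTo n) (λ a → maxPart D R M Q k a + descentPart D R M Q k a)
    ≡⟨ sumOver-+ (oneTo n) (maxPart D R M Q k) (descentPart D R M Q k) ⟩
      sumOver (oneTo n) (maxPart D R M Q k) + sumOver (oneTo n) (descentPart D R M Q k)
    ≡⟨ cong₂ _+_ (sumOver-cong (oneTo n) same-max) same-descents ⟩
      sumOver (oneTo n) (maxPart D′ R′ M Q k) + sumOver (oneTo n) (descentPart D′ R′ M Q k)
    ≡⟨ sym (sumOver-+ (oneTo n) (maxPart D′ R′ M Q k) (descentPart D′ R′ M Q k)) ⟩
      sumOver (oneTo n) (λ a → maxPart D′ R′ M Q k a + descentPart D′ R′ M Q k a)
    ≡⟨ sym (sumOver-cong (oneTo n) (startingWith-split D′ inv′ R′ M Q k (proj₂ (proj₂ v′)))) ⟩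
      sumOver (oneTo n) (startingWith D′ R′ M Q k)
    ≡⟨ sym (completions-suc D′ R′ M Q k) ⟩
      completions D′ R′ M Q (suc k)
    ∎
    where
    open ≡-Reasoning
    -- a new maximum a is available in both states and leads to matching states
    same-max : ∀ a → maxPart D R M Q k a ≡ maxPart D′ R′ M Q k a
    same-max a with M <ᵇ a in M<a
    ... | false = refl
    ... | true rewrite elemᵇ-above M a R R′ same-above M<a with elemᵇ a R′
    ...   | false = refl
    ...   | true = transfer k (remove a R) (remove a R′) a (λ m → Q (a ∷ m)) (valid-max a v) (valid-max a v′)
                      (trans (above-up M a R M<a) (trans (cong (select (a <ᵇ_)) same-above) (sym (above-up M a R′ M<a))))
                      (trans (below-up M a R M<a)
                        (trans (cong₂ _+_ (cong (countᵇ (_<ᵇ a)) same-above) same-below) (sym (below-up M a R′ M<a))))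
    -- all descents lead to states with the same invariants, and there are equally many
    same-descents : sumOver (oneTo n) (descentPart D R M Q k) ≡ sumOver (oneTo n) (descentPart D′ R′ M Q k)
    same-descents =
      sumOver-guarded-eq (oneTo n) (descent D R M) (descent D′ R′ M)
        (λ a → completions D (remove a R) M (λ m → Q (0 ∷ m)) k) (λ b → completions D′ (remove b R′) M (λ m → Q (0 ∷ m)) k)
        after-descents
        (trans (descents D count R M v) (trans (cong₂ choices same-above same-below) (sym (descents D′ count′ R′ M v′))))
      where
      after-descents : ∀ a b → descent D R M a ≡ true → descent D′ R′ M b ≡ true →
        completions D (remove a R) M (λ m → Q (0 ∷ m)) k ≡ completions D′ (remove b R′) M (λ m → Q (0 ∷ m)) k
      after-descents a b da db with descent⇒ D R M a da | descent⇒ D′ R′ M b db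
      ... | M≮a , a∈R | M≮b , b∈R′ =
        transfer k (remove a R) (remove b R′) M (λ m → Q (0 ∷ m)) (valid-descent a v) (valid-descent b v′)
          (trans (above-down M a R M≮a) (trans same-above (sym (above-down M b R′ M≮b))))
          (suc-injective (trans (sym (below-down M a R (sorted⇒distinct (proj₁ v)) a∈R M≮a))
                                (trans same-below (below-down M b R′ (sorted⇒distinct (proj₁ v′)) b∈R′ M≮b))))

-- In each case we
-- split off the smallest remaining letter r: if r > M nothing is below M;
-- otherwise r itself is a descent or not, and for the larger letters the
-- presence of r changes the condition in a controlled way.

remove-head : ∀ r R → All (r <_) R → remove r (r ∷ R) ≡ R
remove-head r R r<R rewrite ≡ᵇ-refl r = select-all (All.map (λ r<x → cong not (≡ᵇ-false (<⇒≢ r<x))) r<R)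

remove-other : ∀ a r L → a ≢ r → remove a (r ∷ L) ≡ r ∷ remove a L
remove-other a r L a≢r rewrite ≡ᵇ-false a≢r = refl

above-all : ∀ M R → All (M <_) R → above M R ≡ R
above-all M R M<R = select-all (All.map <ᵇ-true M<R)

belowCount-none : ∀ M R → All (M <_) R → belowCount M R ≡ 0
belowCount-none M R M<R = trans (countᵇ-cong (All.map (λ M<r → cong not (<ᵇ-true M<r)) M<R)) (countᵇ-false R)

descentsIn : Condition → ℕ → List ℕ → List ℕ → ℕ
descentsIn D M R L = countᵇ (λ a → not (M <ᵇ a) ∧ D M a (remove a R)) L

descents-none : ∀ D M R → All (M <_) R → descentsIn D M R R ≡ choices (above M R) (belowCount M R)
descents-none D M R M<R = trans (countᵇ-cong (All.map (λ {a} M<a → cong (λ b → not b ∧ D M a (remove a R)) (<ᵇ-true M<a)) M<R))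
                               (trans (countᵇ-false R) (sym (cong (choices (above M R)) (belowCount-none M R M<R))))

descents-above-min : ∀ D E M r R → All (r <_) R → (∀ a rest → r < a → D M a (r ∷ rest) ≡ E M a rest) →
  descentsIn D M (r ∷ R) R ≡ descentsIn E M R R
descents-above-min D E M r R r<R reduce = countᵇ-cong (All.map (λ {a} r<a → cong (not (M <ᵇ a) ∧_)
  (trans (cong (D M a) (remove-other a r R (λ a≡r → <-irrefl (sym a≡r) r<a))) (reduce a (remove a R) r<a))) r<R)

descents-min : ∀ D E M r R → All (r <_) R → (M <ᵇ r) ≡ false →
  (∀ a rest → r < a → D M a (r ∷ rest) ≡ E M a rest) →
  descentsIn D M (r ∷ R) (r ∷ R) ≡ (if D M r R then 1 else 0) + descentsIn E M R R
descents-min D E M r R r<R M≮r reduce rewrite M≮r | remove-head r R r<R with D M r R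
... | true  = cong suc (descents-above-min D E M r R r<R reduce)
... | false = descents-above-min D E M r R r<R reduce

descents-by-min : ∀ D M r R → All (r <_) R →
  ((M <ᵇ r) ≡ false → descentsIn D M (r ∷ R) (r ∷ R) ≡ choices (above M (r ∷ R)) (belowCount M (r ∷ R))) →
  descentsIn D M (r ∷ R) (r ∷ R) ≡ choices (above M (r ∷ R)) (belowCount M (r ∷ R))
descents-by-min D M r R r<R below = by-cases (M <ᵇ r) refl
  where
  by-cases : ∀ b → (M <ᵇ r) ≡ b → descentsIn D M (r ∷ R) (r ∷ R) ≡ choices (above M (r ∷ R)) (belowCount M (r ∷ R))
  by-cases false M≮r = below M≮r
  by-cases true  M<r = descents-none D M (r ∷ R) (<ᵇ-true⁻¹ {M} {r} M<r ∷ All.map (<-trans (<ᵇ-true⁻¹ {M} {r} M<r)) r<R)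

-- D₁.  Above the minimum, D₁ M a L says "a exceeds all of L"; exactly the
-- largest letter qualifies, provided it is below M.
exceedsAll : Condition
exceedsAll M a rest = all (_<ᵇ a) rest

D₁-above-min : ∀ M a r L → r < a → D₁ M a (r ∷ L) ≡ exceedsAll M a L
D₁-above-min M a r L r<a rewrite <ᵇ-false {a} {r} (<⇒≤ r<a) | <ᵇ-true r<a = refl

exceedsAll-min : ∀ l L → All (l <_) L → exceedsAll 0 l L ≡ null L
exceedsAll-min l []      l<L = refl
exceedsAll-min l (x ∷ L) (l<x ∷ l<L) rewrite <ᵇ-false {x} {l} (<⇒≤ l<x) = refl

exceedsAll-descents : ∀ M L → AllPairs _<_ L →
  descentsIn exceedsAll M L L ≡ (if null (above M L) then (if null L then 0 else 1) else 0)
exceedsAll-descents M [] s = refl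
exceedsAll-descents M (l ∷ L) (l<L ∷ s) with M <ᵇ l in M<l
... | true = trans (descents-above-min exceedsAll exceedsAll M l L l<L ignore-l)
               (trans (exceedsAll-descents M L s)
               (trans (cong (λ z → if null z then (if null L then 0 else 1) else 0)
                            (above-all M L (All.map (<-trans (<ᵇ-true⁻¹ {M} {l} M<l)) l<L)))
                      (nonempty-zero L)))
  where
  ignore-l : ∀ a rest → l < a → exceedsAll M a (l ∷ rest) ≡ exceedsAll M a rest
  ignore-l a rest l<a = cong (_∧ all (_<ᵇ a) rest) (<ᵇ-true l<a)
  nonempty-zero : ∀ L' → (if null L' then (if null L' then 0 else 1) else 0) ≡ 0
  nonempty-zero []      = refl
  nonempty-zero (_ ∷ _) = refl
... | false rewrite remove-head l L l<L | exceedsAll-min l L l<L with L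
...   | []       = refl
...   | (y ∷ L') = trans (descents-above-min exceedsAll exceedsAll M l (y ∷ L') l<L ignore-l)
                         (exceedsAll-descents M (y ∷ L') s)
  where
  ignore-l : ∀ a rest → l < a → exceedsAll M a (l ∷ rest) ≡ exceedsAll M a rest
  ignore-l a rest l<a = cong (_∧ all (_<ᵇ a) rest) (<ᵇ-true l<a)

countsDescents₁ : CountsDescents D₁
countsDescents₁ M []      s M∉R = refl
countsDescents₁ M (r ∷ R) (r<R ∷ s) (r≢M ∷ M∉R) = descents-by-min D₁ M r R r<R below
  where
  -- the minimum r is a descent (everything after it is larger)
  r-descent : D₁ M r R ≡ true
  r-descent = cong (_∨ all (_<ᵇ r) R) (All⇒all {r <ᵇ_} (All.map <ᵇ-true r<R))
  one-plus : ∀ (A : List ℕ) (b : ℕ) (e : Bool) → e ≡ (null A ∧ (b ≡ᵇ 0)) →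
    suc (if null A then (if e then 0 else 1) else 0) ≡ choices A (suc b)
  one-plus []      zero    .true  refl = refl
  one-plus []      (suc b) .false refl = refl
  one-plus (x ∷ A) zero    .false refl = refl
  one-plus (x ∷ A) (suc b) .false refl = refl
  below : (M <ᵇ r) ≡ false → descentsIn D₁ M (r ∷ R) (r ∷ R) ≡ choices (above M (r ∷ R)) (belowCount M (r ∷ R))
  below M≮r rewrite descents-min D₁ exceedsAll M r R r<R M≮r (λ a rest r<a → D₁-above-min M a r rest r<a)
                  | r-descent | M≮r =
    trans (cong suc (exceedsAll-descents M R s)) (one-plus (above M R) (belowCount M R) (null R) (null-split M R))

-- D₂.  Letters below a do not affect D₂ M a, so the recursion is on R itself;
-- the minimum r is a descent iff it is followed by at most one letter or all
-- following letters exceed M.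
D₂-above-min : ∀ M a r L → r < a → D₂ M a (r ∷ L) ≡ D₂ M a L
D₂-above-min M a r L r<a rewrite <ᵇ-false {a} {r} (<⇒≤ r<a) =
  all-cong L (λ c → cong (not ((a <ᵇ c) ∧ (c <ᵇ M)) ∨_)
                         (cong (_∧ all (λ b → (b ≡ᵇ c) ∨ not (a <ᵇ b)) L) (∨-zeroʳ (r ≡ᵇ c))))

D₂-min-two : ∀ M r c₁ c₂ rest → All (r <_) (c₁ ∷ c₂ ∷ rest) → AllPairs _<_ (c₁ ∷ c₂ ∷ rest) →
  D₂ M r (c₁ ∷ c₂ ∷ rest) ≡ not (c₁ <ᵇ M)
D₂-min-two M r c₁ c₂ rest r<L (c₁<L ∷ c₂<L ∷ s) =
  trans (all-congᴬ (All.map (λ {c} r<c → clause c r<c) r<L)) (smallest-exceeds c₁<L)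
  where
  L = c₁ ∷ c₂ ∷ rest
  all-congᴬ : ∀ {p q : ℕ → Bool} {K} → All (λ x → p x ≡ q x) K → all p K ≡ all q K
  all-congᴬ []       = refl
  all-congᴬ (e ∷ es) = cong₂ _∧_ e (all-congᴬ es)
  not-alone : ∀ c → all (λ b → (b ≡ᵇ c) ∨ not (r <ᵇ b)) L ≡ false
  not-alone c with c₁ ≡ᵇ c in c₁c
  ... | false rewrite <ᵇ-true (All.lookup r<L (here refl)) = refl
  ... | true rewrite <ᵇ-true (All.lookup r<L (there (here refl)))
                   | ≡ᵇ-false {c₂} {c} (λ c₂≡c → <-irrefl (trans (≡ᵇ-true⁻¹ {c₁} {c} c₁c) (sym c₂≡c)) (All.lookup c₁<L (here refl))) = refl
  clause : ∀ c → r < c → (not ((r <ᵇ c) ∧ (c <ᵇ M)) ∨ all (λ b → (b ≡ᵇ c) ∨ not (r <ᵇ b)) L) ≡ not (c <ᵇ M)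
  clause c r<c rewrite <ᵇ-true r<c | not-alone c = ∨-identityʳ _
  smallest-exceeds : All (c₁ <_) (c₂ ∷ rest) → all (λ c → not (c <ᵇ M)) L ≡ not (c₁ <ᵇ M)
  smallest-exceeds c₁<cs with c₁ <ᵇ M in c₁M
  ... | true  = refl
  ... | false = All⇒all (All.map (λ c₁<c → cong not (<ᵇ-false (≤-trans (<ᵇ-false⁻¹ {c₁} {M} c₁M) (<⇒≤ c₁<c)))) c₁<cs)

sorted-head : ∀ {x xs} → AllPairs _<_ (x ∷ xs) → All (x <_) xs
sorted-head (x<xs ∷ _) = x<xs

min-descent-count : ∀ M r R → All (r <_) R → AllPairs _<_ R → All (_≢ M) R →
  ((if D₂ M r R then 1 else 0) + choices (above M R) (belowCount M R)) ≡ choices (above M R) (suc (belowCount M R))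
min-descent-count M r [] r<R s M∉R = refl
min-descent-count M r (c ∷ []) (r<c ∷ []) s (c≢M ∷ []) with <-cmp c M
... | tri< c<M _ _ rewrite <ᵇ-true r<c | <ᵇ-true c<M | <ᵇ-false {M} {c} (<⇒≤ c<M) | ≡ᵇ-refl c = refl
... | tri≈ _ c≡M _ = ⊥-elim (c≢M c≡M)
... | tri> _ _ M<c rewrite <ᵇ-true r<c | <ᵇ-true M<c | <ᵇ-false {c} {M} (<⇒≤ M<c) = refl
min-descent-count M r (c₁ ∷ c₂ ∷ rest) r<R s (c₁≢M ∷ M∉R) rewrite D₂-min-two M r c₁ c₂ rest r<R s with <-cmp c₁ M
... | tri≈ _ c₁≡M _ = ⊥-elim (c₁≢M c₁≡M)
... | tri> _ _ M<c₁ rewrite <ᵇ-false {c₁} {M} (<⇒≤ M<c₁)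
                          | belowCount-none M (c₁ ∷ c₂ ∷ rest) (M<c₁ ∷ All.map (<-trans M<c₁) (sorted-head s)) = refl
... | tri< c₁<M _ _ rewrite <ᵇ-true c₁<M | <ᵇ-false {M} {c₁} (<⇒≤ c₁<M) = grows (belowCount M (c₂ ∷ rest)) refl
  where
  -- a single letter below M besides c₁ forces a letter above M
  grows : ∀ b → belowCount M (c₂ ∷ rest) ≡ b → choices (above M (c₂ ∷ rest)) (suc b) ≡ choices (above M (c₂ ∷ rest)) (suc (suc b))
  grows (suc b) e = refl
  grows zero e with null-split M (c₂ ∷ rest)
  ... | split rewrite e with null (above M (c₂ ∷ rest))
  ...   | false = refl
  ...   | true with split
  ...     | ()

countsDescents₂ : CountsDescents D₂
countsDescents₂ M []      s M∉R = refl
countsDescents₂ M (r ∷ R) (r<R ∷ s) (r≢M ∷ M∉R) = descents-by-min D₂ M r R r<R below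
  where
  below : (M <ᵇ r) ≡ false → descentsIn D₂ M (r ∷ R) (r ∷ R) ≡ choices (above M (r ∷ R)) (belowCount M (r ∷ R))
  below M≮r rewrite descents-min D₂ D₂ M r R r<R M≮r (λ a rest r<a → D₂-above-min M a r rest r<a)
                  | countsDescents₂ M R s M∉R | M≮r = min-descent-count M r R r<R s M∉R

length-filter : ∀ {A : Set} {P : Pred A Level.zero} (P? : Decidable P) L →
  length (filter P? L) ≡ countᵇ (λ x → does (P? x)) L
length-filter P? [] = refl
length-filter P? (x ∷ L) with does (P? x)
... | true  = cong suc (length-filter P? L)
... | false = length-filter P? L

countᵇ-filter : ∀ {A : Set} {P : Pred A Level.zero} (P? : Decidable P) (q : A → Bool) L →
  countᵇ q (filter P? L) ≡ countᵇ (λ x → does (P? x) ∧ q x) L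
countᵇ-filter P? q [] = refl
countᵇ-filter P? q (x ∷ L) with does (P? x)
... | false = countᵇ-filter P? q L
... | true with q x
...   | true  = cong suc (countᵇ-filter P? q L)
...   | false = countᵇ-filter P? q L

Word : ℕ → ℕ → List ℕ → Set
Word n k w = All (λ a → elemᵇ a (oneTo n) ≡ true) w × length w ≡ k

words-are-words : ∀ n k → All (Word n k) (words n k)
words-are-words n zero    = ([] , refl) ∷ []
words-are-words n (suc k) = prefixed (oneTo n) (λ a a∈ → a∈)
  where
  prefixed : ∀ L → (∀ a → elemᵇ a L ≡ true → elemᵇ a (oneTo n) ≡ true) →
    All (Word n (suc k)) (concatMap (λ a → map (a ∷_) (words n k)) L)
  prefixed []      L⊆ = []
  prefixed (a ∷ L) L⊆ =
    AllP.++⁺ (AllP.map⁺ (All.map (λ { (w⊆ , len) → (L⊆ a (elemᵇ-here a L) ∷ w⊆) , cong suc len }) (words-are-words n k)))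
             (prefixed L (λ b b∈ → L⊆ b (elemᵇ-there a L b∈)))

oneTo-range : ∀ n a → elemᵇ a (oneTo n) ≡ true → (1 ≤ a) × (a ≤ n)
oneTo-range n a e with AnyP.applyUpTo⁻ (λ x → x) (AnyP.map⁻ (elemᵇ⇒∈ {a} {oneTo n} e))
... | i , i<n , refl = s≤s z≤n , i<n

oneTo-positive : ∀ n {w} → All (λ a → elemᵇ a (oneTo n) ≡ true) w → All (_≢ 0) w
oneTo-positive n = All.map (λ {a} a∈ a≡0 → <-irrefl (sym a≡0) (proj₁ (oneTo-range n a a∈)))

elemᵇ-self : ∀ L → All (λ a → elemᵇ a L ≡ true) L
elemᵇ-self []      = []
elemᵇ-self (x ∷ L) = elemᵇ-here x L ∷ All.map (λ {a} a∈ → elemᵇ-there x L a∈) (elemᵇ-self L)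

length-oneTo : ∀ n → length (oneTo n) ≡ n
length-oneTo n = trans (length-map suc (upTo n)) (length-upTo n)

arranges⇒distinct : ∀ R w → arranges R w ≡ true → AllPairs _≢_ w
arranges⇒distinct R []       e = []
arranges⇒distinct R (x ∷ xs) e with elemᵇ x R
... | true = x∉xs ∷ arranges⇒distinct (remove x R) xs e
  where
  x-absent : elemᵇ x xs ≡ false
  x-absent = trans (arranges⇒sameElems (remove x R) xs e x) (trans (elemᵇ-remove x x R) (cong (λ b → not b ∧ elemᵇ x R) (≡ᵇ-refl x)))
  absent⇒All : ∀ L → elemᵇ x L ≡ false → All (x ≢_) L
  absent⇒All []      _ = []
  absent⇒All (y ∷ L) e = ≡ᵇ-false⁻¹ (∨-conicalˡ _ _ e) ∷ absent⇒All L (∨-conicalʳ (x ≡ᵇ y) _ e)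
  x∉xs : All (x ≢_) xs
  x∉xs = absent⇒All xs x-absent

length-remove : ∀ x R → AllPairs _≢_ R → elemᵇ x R ≡ true → length R ≡ suc (length (remove x R))
length-remove x R u x∈ =
  trans (sym (countᵇ-true R))
  (trans (countᵇ-split (λ _ → true) (x ≡ᵇ_) R)
  (cong₂ _+_ (countᵇ-single (λ _ → true) x R u x∈ refl) (sym (length-select (λ r → not (x ≡ᵇ r)) R))))

distinct⇒arranges : ∀ R w → AllPairs _≢_ R → AllPairs _≢_ w → All (λ a → elemᵇ a R ≡ true) w →
  length w ≡ length R → arranges R w ≡ true
distinct⇒arranges [] []       uR uw w⊆R len = refl
distinct⇒arranges R  (x ∷ xs) uR (x∉xs ∷ uw) (x∈R ∷ xs⊆R) len rewrite x∈R =
  distinct⇒arranges (remove x R) xs (AllPairs-select _ uR) uw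
    (All.zipWith (λ {z} (x≢z , z∈R) → trans (elemᵇ-remove x z R) (trans (cong (λ b → not b ∧ elemᵇ z R) (≡ᵇ-false x≢z)) z∈R))
                 (x∉xs , xs⊆R))
    (suc-injective (trans len (length-remove x R uR x∈R)))

does-≟-true : ∀ b → does (b Data.Bool.≟ true) ≡ b
does-≟-true true  = refl
does-≟-true false = refl

module FromPermutations (n : ℕ) (T : List (List ℕ)) (D : Condition)
         (avoids : ∀ w → AllPairs _≢_ w → All (_≢ 0) w → avoidsAll T w ≡ admissible D 0 w) where
  open Completions n

  pointwise : (st : List ℕ → ℕ) (st′ : List ℕ → ℕ) → (∀ w → Word n n w → st w ≡ st′ (shape 0 w)) → ∀ j w → Word n n w →
    (does (unique? _≟_ w) ∧ (does (avoidsAll T w Data.Bool.≟ true) ∧ does (st w ≟ j)))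
      ≡ (generates D (oneTo n) 0 w ∧ (st′ (shape 0 w) ≡ᵇ j))
  pointwise st st′ factors j w word with unique? _≟_ w
  ... | yes u rewrite generates-split D (oneTo n) 0 w
                    | distinct⇒arranges (oneTo n) w (sorted⇒distinct (oneTo-sorted n)) u (proj₁ word)
                                        (trans (proj₂ word) (sym (length-oneTo n)))
                    | does-≟-true (avoidsAll T w) | avoids w u (oneTo-positive n (proj₁ word)) | factors w word = refl
  ... | no ¬u rewrite generates-split D (oneTo n) 0 w with arranges (oneTo n) w in arr
  ...   | false = refl
  ...   | true  = ⊥-elim (¬u (arranges⇒distinct (oneTo n) w arr))

  countStat≡completions : (st st′ : List ℕ → ℕ) → (∀ w → Word n n w → st w ≡ st′ (shape 0 w)) → ∀ j →
    countStat st j (Av n T) ≡ completions D (oneTo n) 0 (λ m → st′ m ≡ᵇ j) n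
  countStat≡completions st st′ factors j =
    begin
      countStat st j (Av n T)
    ≡⟨ length-filter (λ σ → st σ ≟ j) (Av n T) ⟩
      countᵇ (λ σ → does (st σ ≟ j)) (Av n T)
    ≡⟨ countᵇ-filter (λ σ → avoidsAll T σ Data.Bool.≟ true) (λ σ → does (st σ ≟ j)) (S n) ⟩
      countᵇ (λ σ → does (avoidsAll T σ Data.Bool.≟ true) ∧ does (st σ ≟ j)) (S n)
    ≡⟨ countᵇ-filter (λ w → unique? _≟_ w) (λ σ → does (avoidsAll T σ Data.Bool.≟ true) ∧ does (st σ ≟ j)) (words n n) ⟩
      countᵇ (λ w → does (unique? _≟_ w) ∧ (does (avoidsAll T w Data.Bool.≟ true) ∧ does (st w ≟ j))) (words n n)
    ≡⟨ countᵇ-cong (All.map (λ {w} word → pointwise st st′ factors j w word) (words-are-words n n)) ⟩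
      completions D (oneTo n) 0 (λ m → st′ m ≡ᵇ j) n
    ∎
    where open ≡-Reasoning

-- σ(1) is always a left-to-right maximum
first-shape : ∀ w → All (1 ≤_) w → first w ≡ first (shape 0 w)
first-shape []      _         = refl
first-shape (x ∷ w) (1≤x ∷ _) rewrite <ᵇ-true {0} {x} 1≤x = refl

lrmax-shape : ∀ M w → lrmaxFrom M (shape M w) ≡ lrmaxFrom M w
lrmax-shape M []      = refl
lrmax-shape M (x ∷ w) with M <ᵇ x in M<x
... | true rewrite M<x = cong suc (lrmax-shape x w)
... | false = lrmax-shape M w

-- the maximal letter n is a left-to-right maximum, so its position is seen in the shape
posOf-shape : ∀ n M w → 1 ≤ n → All (_≤ n) w → (elemᵇ n w ≡ true → M < n) → posOf n (shape M w) ≡ posOf n w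
posOf-shape n M []      1≤n w≤n M<n = refl
posOf-shape n M (x ∷ w) 1≤n (x≤n ∷ w≤n) M<n with x ≡ᵇ n in x≡n
... | true rewrite ≡ᵇ-true⁻¹ {x} {n} x≡n | <ᵇ-true (M<n (cong (_∨ elemᵇ n w) (≡ᵇ-refl n))) | ≡ᵇ-refl n = refl
... | false with M <ᵇ x in M<x
...   | true rewrite x≡n = cong suc (posOf-shape n x w 1≤n w≤n (λ _ → ≤∧≢⇒< x≤n (≡ᵇ-false⁻¹ x≡n)))
...   | false rewrite ≡ᵇ-false {0} {n} (λ 0≡n → <-irrefl 0≡n 1≤n) =
  cong suc (posOf-shape n M w 1≤n w≤n (λ n∈w → M<n (elemᵇ-there x w n∈w)))

module Equidistribution (n : ℕ) where
  open Completions n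

  start : Valid (oneTo n) 0
  start = oneTo-sorted n , elemᵇ-self (oneTo n) , oneTo-positive n (elemᵇ-self (oneTo n))

  equidistributed : (st st′ : List ℕ → ℕ) → (∀ w → Word n n w → st w ≡ st′ (shape 0 w)) → ∀ j →
    countStat st j (Av n T₁) ≡ countStat st j (Av n T₂)
  equidistributed st st′ factors j =
    begin
      countStat st j (Av n T₁)
    ≡⟨ FromPermutations.countStat≡completions n T₁ D₁ avoids-T₁ st st′ factors j ⟩
      completions D₁ (oneTo n) 0 (λ m → st′ m ≡ᵇ j) n
    ≡⟨ Transfer.transfer n D₁ D₂ D₁-setInvariant D₂-setInvariant countsDescents₁ countsDescents₂
                         n (oneTo n) (oneTo n) 0 (λ m → st′ m ≡ᵇ j) start start refl refl ⟩
      completions D₂ (oneTo n) 0 (λ m → st′ m ≡ᵇ j) n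
    ≡⟨ sym (FromPermutations.countStat≡completions n T₂ D₂ avoids-T₂ st st′ factors j) ⟩
      countStat st j (Av n T₂)
    ∎
    where open ≡-Reasoning

proposition8 : ∀ (n : ℕ) → n ≥ 1 → ∀ (j : ℕ) →
    (countStat first j (Av n T₁) ≡ countStat first j (Av n T₂))
    × (countStat (posMax n) j (Av n T₁) ≡ countStat (posMax n) j (Av n T₂))
    × (countStat lrmax j (Av n T₁) ≡ countStat lrmax j (Av n T₂))
proposition8 n 1≤n j =
    equidistributed first first first-factors j
  , equidistributed (posMax n) (posOf n) posMax-factors j
  , equidistributed lrmax (lrmaxFrom 0) (λ w _ → sym (lrmax-shape 0 w)) j
  where
  open Equidistribution n
  first-factors : ∀ w → Word n n w → first w ≡ first (shape 0 w)
  first-factors w (w⊆ , _) = first-shape w (All.map (λ {a} a∈ → proj₁ (oneTo-range n a a∈)) w⊆)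
  posMax-factors : ∀ w → Word n n w → posMax n w ≡ posOf n (shape 0 w)
  posMax-factors w (w⊆ , _) = sym (posOf-shape n 0 w 1≤n (All.map (λ {a} a∈ → proj₂ (oneTo-range n a a∈)) w⊆) (λ _ → 1≤n))
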